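{- Let $p$ be a prime. For every positive integer $m$ there is a juggling function $g:\mathbb Z_p\to\mathbb Z_p$ of type $m$ such that the function $F:\mathbb Z_p\to\mathbb Z_p^2$, $F(x)=(x,g(x))$, is computed by a $\mathrm{pReLU}$-network of width $2$ (input dimension $1$, output dimension $2$).
   Context: $\mathbb Q_p$ denotes the $p$-adic numbers and $\mathbb Z_p$ the $p$-adic integers. A juggling function of type $m$ is a function $g:\mathbb Z_p\to\mathbb Z_p$ such that for every $y\in\mathbb Z_p$ and every coset $D$ of $p^m\mathbb Z_p$ in $\mathbb Z_p$ we have $g^{ -1}(y)\cap D\neq\emptyset$. The function $\mathrm{pReLU}:\mathbb Q_p\to\mathbb Q_p$ is defined by $\mathrm{pReLU}(x)=x$ if $x\in\mathbb Z_p$ and $0$ otherwise. A $\mathrm{pReLU}$-network with input dimension $d_x$, output dimension $d_y$ and hidden layer dimensions $d_1,\dots,d_{L-1}$ is a composition $t_L\circ\Sigma_{L-1}\circ t_{L-1}\circ\cdots\circ t_2\circ\Sigma_1\circ t_1:\mathbb Q_p^{d_x}\to\mathbb Q_p^{d_y}$, where (with $d_0=d_x$, $d_L=d_y$) each $t_l:\mathbb Q_p^{d_{l-1}}\to\mathbb Q_p^{d_l}$ is an affine map with coefficients in $\mathbb Q_p$ and $\Sigma_l$ applies $\mathrm{pReLU}$ to each coordinate. Its width is $\max(d_1,\dots,d_{L-1})$. A network computes a function on a set $X$ if its restriction to $X$ equals that function. -}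

module Defs where

open import Data.Nat as ℕ using (ℕ; zero; suc; NonZero; _<ᵇ_; _≡ᵇ_; _⊔_)
open import Data.Nat.DivMod using (_mod_; _/_)
open import Data.Integer as ℤ using (ℤ; +_; -[1+_]; ∣_∣; _⊓_)
open import Data.Fin as Fin using (Fin; toℕ; opposite)
open import Data.Bool using (Bool; true; false; if_then_else_; _∧_)
open import Data.List using (List; []; _∷_; upTo; map)
open import Data.Nat.ListAction using (sum)
open import Data.Product using (Σ; _×_; _,_; proj₁; proj₂)
open import Relation.Binary.PropositionalEquality using (_≡_)

-- p-adic integers ℤ_p as digit streams  x = Σ_n (digit n) p^n.
-- (Each p-adic integer has a unique such expansion, so equality is
-- pointwise equality of digits.)

module _ (p : ℕ) .{{_ : NonZero p}} where

  Zp : Set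
  Zp = ℕ → Fin p

  infix 4 _≈z_
  _≈z_ : Zp → Zp → Set
  x ≈z y = ∀ n → x n ≡ y n

  dig : ℕ → Fin p
  dig k = k mod p

  zeroZ : Zp
  zeroZ _ = dig 0

  oneZ : Zp
  oneZ zero    = dig 1
  oneZ (suc _) = dig 0

  addCarry : Zp → Zp → ℕ → ℕ
  addCarry x y zero    = 0
  addCarry x y (suc n) = (toℕ (x n) ℕ.+ toℕ (y n) ℕ.+ addCarry x y n) / p

  _+z_ : Zp → Zp → Zp
  (x +z y) n = dig (toℕ (x n) ℕ.+ toℕ (y n) ℕ.+ addCarry x y n)

  conv : Zp → Zp → ℕ → ℕ
  conv x y n = sum (map (λ i → toℕ (x i) ℕ.* toℕ (y (n ℕ.∸ i))) (upTo (suc n)))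

  mulCarry : Zp → Zp → ℕ → ℕ
  mulCarry x y zero    = 0
  mulCarry x y (suc n) = (conv x y n ℕ.+ mulCarry x y n) / p

  _*z_ : Zp → Zp → Zp
  (x *z y) n = dig (conv x y n ℕ.+ mulCarry x y n)

  infixl 6 _+z_
  infixl 7 _*z_

  -z_ : Zp → Zp
  -z x = (λ n → opposite (x n)) +z oneZ

  -- multiplication by p^s (shift digits up by s)
  shiftZ : ℕ → Zp → Zp
  shiftZ s x n = if n <ᵇ s then dig 0 else x (n ℕ.∸ s)

  -- p-adic numbers ℚ_p: a pair (k , u) represents p^k · u, u ∈ ℤ_p.

  record Qp : Set where
    constructor _∙p^_
    field
      unit : Zp
      expo : ℤ
  open Qp public

  align : Qp → Qp → Zp × Zp
  align (u ∙p^ k) (v ∙p^ j) =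
    (shiftZ (∣ k ℤ.- (k ⊓ j) ∣) u , shiftZ (∣ j ℤ.- (k ⊓ j) ∣) v)

  infix 4 _≈_
  _≈_ : Qp → Qp → Set
  a ≈ b = proj₁ (align a b) ≈z proj₂ (align a b)

  _+q_ : Qp → Qp → Qp
  a +q b = (proj₁ (align a b) +z proj₂ (align a b))
             ∙p^ (expo a ⊓ expo b)

  _*q_ : Qp → Qp → Qp
  (u ∙p^ k) *q (v ∙p^ j) = (u *z v) ∙p^ (k ℤ.+ j)

  0q : Qp
  0q = zeroZ ∙p^ (+ 0)

  ι : Zp → Qp
  ι u = u ∙p^ (+ 0)

  firstZero : Zp → ℕ → Bool
  firstZero u zero    = true
  firstZero u (suc k) = (toℕ (u k) ≡ᵇ 0) ∧ firstZero u k

  inZp : Qp → Bool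
  inZp (u ∙p^ (+ _))      = true
  inZp (u ∙p^ -[1+ n ])   = firstZero u (suc n)

  pReLU : Qp → Qp
  pReLU x = if inZp x then x else 0q

  Vecq : ℕ → Set
  Vecq d = Fin d → Qp

  sumq : ∀ {d} → Vecq d → Qp
  sumq {zero}  f = 0q
  sumq {suc d} f = f Fin.zero +q sumq (λ i → f (Fin.suc i))

  record Affine (a b : ℕ) : Set where
    field
      matrix : Fin b → Fin a → Qp
      bias   : Fin b → Qp

  applyAffine : ∀ {a b} → Affine a b → Vecq a → Vecq b
  applyAffine t x i = Affine.bias t i +q sumq (λ j → Affine.matrix t i j *q x j)

  data Net : ℕ → ℕ → Set where
    output : ∀ {a b}   → Affine a b → Net a b
    hidden : ∀ {a d b} → Affine a d → Net d b → Net a b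

  eval : ∀ {a b} → Net a b → Vecq a → Vecq b
  eval (output t)   x = applyAffine t x
  eval (hidden t N) x = eval N (λ i → pReLU (applyAffine t x i))

  width : ∀ {a b} → Net a b → ℕ
  width (output t)           = 0
  width (hidden {d = d} t N) = d ⊔ width N

  InCoset : ℕ → Zp → Zp → Set
  InCoset m a x = Σ Zp (λ z → x ≈z a +z shiftZ m z)

  IsJuggling : ℕ → (Zp → Zp) → Set
  IsJuggling m g = (y a : Zp) → Σ Zp (λ x → InCoset m a x × g x ≈z y)

-- Hidden layer k of the network keeps x in one neuron and replaces w in the other by
-- pReLU(p^-m (x + w - k)), which is nonzero only if x + w ≡ k (mod p^m). Run the layers
-- k = 0, …, p^m - 1 starting from w = 0. If x ≡ j (mod p^m), the layers k < j leave w = 0 and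
-- layer j yields (x - j)/p^m. Running the later layers backwards from a prescribed output y, the
-- value needed after layer j is an affine function A - βx of x, so x has to solve
-- x - j = p^m (A - βx), i.e. (1 + p^m β) x = j + p^m A. Since 1 + p^m β ≡ 1 (mod p), this equation
-- has a solution in ℤ_p, built digit by digit, and it lies in the coset j + p^m ℤ_p.
-- Identities in ℤ_p are checked on the residues of the first n digits modulo every p^n, and
-- equality in ℚ_p is reduced to equality in ℤ_p by multiplying with a large power of p.

module Submission where

open import Defs
open import Data.Nat using (ℕ; NonZero; _≤_)
open import Data.Nat.Primality using (Prime)
open import Data.Fin using (Fin; zero; suc)
open import Data.Product using (Σ; _×_)
open import Relation.Binary.PropositionalEquality using (_≡_)

open import Data.Nat.Primality using (prime⇒nonTrivial)
open import Data.Product using (_,_; proj₁; proj₂)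
import Data.Nat as ℕ
import Data.Nat.Properties as ℕ
import Data.Nat.Divisibility as ℕ
import Data.Nat.DivMod as ℕ
open import Data.Integer as ℤ using (ℤ; +_; -[1+_]; ∣_∣)
import Data.Integer.Properties as ℤ
open import Data.Integer.DivMod using (_%ℕ_; _/ℕ_; a≡a%ℕn+[a/ℕn]*n; n%ℕd<d)
import Data.Integer.Tactic.RingSolver as ℤ-Solver
import Relation.Binary.Reasoning.Setoid
open import Data.Empty using (⊥-elim)
open import Relation.Binary.Bundles using (Setoid)
open import Relation.Binary.Structures using (IsEquivalence)
open import Relation.Binary.PropositionalEquality using (refl; sym; trans; cong; cong₂; subst)
open import Relation.Nullary using (contradiction)

module Congruence where
  open import Data.Integer using (_+_; _*_; -_; _-_)
  open import Data.Integer.Divisibility.Signed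
    using (_∣_; divides; ∣-trans; ∣⇒∣ᵤ; module ∣-Reasoning; ∣m∣n⇒∣m+n; ∣m⇒∣-m; ∣n⇒∣m*n; *-monoʳ-∣)
  open ℤ-Solver using (solve)
  open import Data.List using (_∷_; [])

  -- A record rather than the bare divisibility P ∣ a - b, so that a and b can be inferred.
  infix 4 _≡_[mod_]
  record _≡_[mod_] (a b P : ℤ) : Set where
    constructor mod-by
    field divides-difference : P ∣ a - b

  module _ {P : ℤ} where
    open ∣-Reasoning

    ≡⇒≡-mod : ∀ {a b} → a ≡ b → a ≡ b [mod P ]
    ≡⇒≡-mod {a} refl = mod-by (divides (+ 0) (ℤ.+-inverseʳ a))

    ≡-mod-refl : ∀ {a} → a ≡ a [mod P ]
    ≡-mod-refl = ≡⇒≡-mod refl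

    ≡-mod-sym : ∀ {a b} → a ≡ b [mod P ] → b ≡ a [mod P ]
    ≡-mod-sym {a} {b} (mod-by P∣a-b) = mod-by (begin
      P            ∣⟨ ∣m⇒∣-m P∣a-b ⟩
      - (a - b)    ≡⟨ solve (a ∷ b ∷ []) ⟩
      b - a        ∎)

    ≡-mod-trans : ∀ {a b c} → a ≡ b [mod P ] → b ≡ c [mod P ] → a ≡ c [mod P ]
    ≡-mod-trans {a} {b} {c} (mod-by P∣a-b) (mod-by P∣b-c) = mod-by (begin
      P                   ∣⟨ ∣m∣n⇒∣m+n P∣a-b P∣b-c ⟩
      (a - b) + (b - c)   ≡⟨ solve (a ∷ b ∷ c ∷ []) ⟩
      a - c               ∎)

    ≡-mod-isEquivalence : IsEquivalence _≡_[mod P ]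
    ≡-mod-isEquivalence = record { refl = ≡-mod-refl ; sym = ≡-mod-sym ; trans = ≡-mod-trans }

    +-cong-mod : ∀ {a b c d} → a ≡ b [mod P ] → c ≡ d [mod P ] → a + c ≡ b + d [mod P ]
    +-cong-mod {a} {b} {c} {d} (mod-by P∣a-b) (mod-by P∣c-d) = mod-by (begin
      P                   ∣⟨ ∣m∣n⇒∣m+n P∣a-b P∣c-d ⟩
      (a - b) + (c - d)   ≡⟨ solve (a ∷ b ∷ c ∷ d ∷ []) ⟩
      (a + c) - (b + d)   ∎)

    +-congˡ-mod : ∀ c {a b} → a ≡ b [mod P ] → c + a ≡ c + b [mod P ]
    +-congˡ-mod c = +-cong-mod (≡-mod-refl {c})

    +-congʳ-mod : ∀ c {a b} → a ≡ b [mod P ] → a + c ≡ b + c [mod P ]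
    +-congʳ-mod c a≡b = +-cong-mod a≡b (≡-mod-refl {c})

    -‿cong-mod : ∀ {a b} → a ≡ b [mod P ] → - a ≡ - b [mod P ]
    -‿cong-mod {a} {b} (mod-by P∣a-b) = mod-by (begin
      P                   ∣⟨ ∣m⇒∣-m P∣a-b ⟩
      - (a - b)           ≡⟨ solve (a ∷ b ∷ []) ⟩
      - a - - b           ∎)

    *-congˡ-mod : ∀ k {a b} → a ≡ b [mod P ] → k * a ≡ k * b [mod P ]
    *-congˡ-mod k {a} {b} (mod-by P∣a-b) = mod-by (begin
      P                   ∣⟨ ∣n⇒∣m*n k P∣a-b ⟩
      k * (a - b)         ≡⟨ solve (k ∷ a ∷ b ∷ []) ⟩
      k * a - k * b       ∎)

    +-multiple⇒≡-mod : ∀ {a b} k → a + k * P ≡ b → a ≡ b [mod P ]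
    +-multiple⇒≡-mod {a} k refl = mod-by (divides (- k) (solve (a ∷ k ∷ P ∷ [])))

    multiple≡0-mod : ∀ a → a * P ≡ + 0 [mod P ]
    multiple≡0-mod a = mod-by (divides a (ℤ.+-identityʳ (a * P)))

    ≡-mod-weaken : ∀ {a b} Q → a ≡ b [mod Q * P ] → a ≡ b [mod P ]
    ≡-mod-weaken Q (mod-by QP∣a-b) = mod-by (∣-trans (divides Q refl) QP∣a-b)

    *-cong-mod-scaled : ∀ k {a b} → a ≡ b [mod P ] → k * a ≡ k * b [mod k * P ]
    *-cong-mod-scaled k {a} {b} (mod-by P∣a-b) = mod-by (begin
      k * P               ∣⟨ *-monoʳ-∣ k P∣a-b ⟩
      k * (a - b)         ≡⟨ solve (k ∷ a ∷ b ∷ []) ⟩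
      k * a - k * b       ∎)

  ≡-mod-cong-modulus : ∀ {a b P Q} → P ≡ Q → a ≡ b [mod P ] → a ≡ b [mod Q ]
  ≡-mod-cong-modulus refl a≡b = a≡b

  ≡-mod-setoid : ℤ → Setoid _ _
  ≡-mod-setoid P = record { isEquivalence = ≡-mod-isEquivalence {P} }

  module ≡-mod-Reasoning (P : ℤ) = Relation.Binary.Reasoning.Setoid (≡-mod-setoid P)

  pos-+-* : ∀ a k P → + (a ℕ.+ k ℕ.* P) ≡ + a + + k * + P
  pos-+-* a k P = trans (ℤ.pos-+ a (k ℕ.* P)) (cong (λ t → + a + t) (ℤ.pos-* k P))

  ≡-mod-1 : ∀ a b → a ≡ b [mod + 1 ]
  ≡-mod-1 a b = +-multiple⇒≡-mod (b - a) (solve (a ∷ b ∷ []))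

  %-≡-mod : ∀ a P .{{_ : NonZero P}} → + (a ℕ.% P) ≡ + a [mod + P ]
  %-≡-mod a P = +-multiple⇒≡-mod (+ (a ℕ./ P))
    (trans (sym (pos-+-* (a ℕ.% P) (a ℕ./ P) P)) (cong +_ (sym (ℕ.m≡m%n+[m/n]*n a P))))

  %ℕ-≡-mod : ∀ a P .{{_ : NonZero P}} → + (a %ℕ P) ≡ a [mod + P ]
  %ℕ-≡-mod a P = +-multiple⇒≡-mod (a /ℕ P) (sym (a≡a%ℕn+[a/ℕn]*n a P))

  ≡-mod⇒≡ : ∀ {a b P} → a ℕ.< P → b ℕ.< P → + a ≡ + b [mod + P ] → a ≡ b
  ≡-mod⇒≡ {a} {b} {P} a<P b<P (mod-by P∣a-b) with ∣ + a - + b ∣ in eq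
  ... | ℕ.zero  = ℤ.+-injective (ℤ.i-j≡0⇒i≡j (+ a) (+ b) (ℤ.∣i∣≡0⇒i≡0 eq))
  ... | ℕ.suc d = contradiction (ℕ.∣⇒≤ (subst (P ℕ.∣_) eq (∣⇒∣ᵤ P∣a-b))) (ℕ.<⇒≱ ∣a-b∣<P)
    where
    ∣a-b∣<P : ℕ.suc d ℕ.< P
    ∣a-b∣<P = ℕ.≤-<-trans
      (subst (ℕ._≤ a ℕ.⊔ b) (trans (cong ∣_∣ (sym (ℤ.m-n≡m⊖n a b))) eq) (ℤ.∣m⊝n∣≤m⊔n a b))
      (ℕ.⊔-lub a<P b<P)

module DigitStreams (p : ℕ) .{{_ : NonZero p}} where
  open import Data.Nat using (_+_; _*_; _^_; _∸_; _<_; _<ᵇ_; z≤n; s≤s)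
  open import Data.Nat.DivMod using (_%_; _/_; m%n<n; m<n⇒m%n≡m; m≡m%n+[m/n]*n; 0/n≡0)
  open import Data.List using (map; applyUpTo)
  open import Data.Nat.ListAction using (sum)
  open import Data.Fin using (toℕ; opposite)
  open import Data.Fin.Properties using (toℕ<n; toℕ-fromℕ<; toℕ-injective; opposite-prop)
  open import Data.Bool using (true; false; T)
  open import Data.Bool.Properties using (∧-conicalˡ; ∧-conicalʳ)
  open import Data.Sum using (inj₁; inj₂)
  open import Data.Nat.Tactic.RingSolver using (solve-∀)

  -- _≈z_ in a record, so that the two sides can be inferred from a proof.
  infix 4 _≃_
  record _≃_ (x y : Zp p) : Set where
    constructor digitwise
    field digit-eq : _≈z_ p x y
  open _≃_ public

  ≃-refl : ∀ {x} → x ≃ x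
  ≃-refl = digitwise (λ _ → refl)

  ≃-sym : ∀ {x y} → x ≃ y → y ≃ x
  ≃-sym x≃y = digitwise (λ n → sym (digit-eq x≃y n))

  ≃-trans : ∀ {x y z} → x ≃ y → y ≃ z → x ≃ z
  ≃-trans x≃y y≃z = digitwise (λ n → trans (digit-eq x≃y n) (digit-eq y≃z n))

  ≡⇒≃ : ∀ {x y} → x ≡ y → x ≃ y
  ≡⇒≃ refl = ≃-refl

  ≃-setoid : Setoid _ _
  ≃-setoid = record { _≈_ = _≃_ ; isEquivalence = record { refl = ≃-refl ; sym = ≃-sym ; trans = ≃-trans } }

  module ≃-Reasoning = Relation.Binary.Reasoning.Setoid ≃-setoid

  toℕ-dig : ∀ k → toℕ (dig p k) ≡ k % p
  toℕ-dig k = toℕ-fromℕ< (m%n<n k p)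

  toℕ-dig-< : ∀ {k} → k < p → toℕ (dig p k) ≡ k
  toℕ-dig-< {k} k<p = trans (toℕ-dig k) (m<n⇒m%n≡m k<p)

  toℕ-dig-0 : toℕ (dig p 0) ≡ 0
  toℕ-dig-0 = toℕ-dig-< (ℕ.>-nonZero⁻¹ p)

  drop : ℕ → Zp p → Zp p
  drop s x n = x (s + n)

  shiftZ-low : ∀ s x {n} → n < s → toℕ (shiftZ p s x n) ≡ 0
  shiftZ-low s x {n} n<s with n <ᵇ s in eq
  ... | true  = toℕ-dig-0
  ... | false = ⊥-elim (subst T eq (ℕ.<⇒<ᵇ n<s))

  shiftZ-high : ∀ s x n → shiftZ p s x (s + n) ≡ x n
  shiftZ-high s x n with (s + n) <ᵇ s in eq
  ... | true  = contradiction (ℕ.<ᵇ⇒< (s + n) s (subst T (sym eq) _)) (ℕ.m+n≮m s n)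
  ... | false = cong x (ℕ.m+n∸m≡n s n)

  shiftZ-cong : ∀ s {x y} → x ≃ y → shiftZ p s x ≃ shiftZ p s y
  shiftZ-cong s {x} {y} x≃y = digitwise digits
    where
    digits : ∀ n → shiftZ p s x n ≡ shiftZ p s y n
    digits n with n <ᵇ s
    ... | true  = refl
    ... | false = digit-eq x≃y (n ∸ s)

  drop-cong : ∀ s {x y} → x ≃ y → drop s x ≃ drop s y
  drop-cong s x≃y = digitwise (λ n → digit-eq x≃y (s + n))

  drop-shiftZ : ∀ s x → drop s (shiftZ p s x) ≃ x
  drop-shiftZ s x = digitwise (shiftZ-high s x)

  low-digits≡0⇒≃shiftZ : ∀ s {x} → (∀ {i} → i < s → toℕ (x i) ≡ 0) → x ≃ shiftZ p s (drop s x)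
  low-digits≡0⇒≃shiftZ s {x} low≡0 = digitwise digits
    where
    digits : ∀ n → x n ≡ shiftZ p s (drop s x) n
    digits n with n <ᵇ s in eq
    ... | true  = toℕ-injective (trans (low≡0 (ℕ.<ᵇ⇒< n s (subst T (sym eq) _))) (sym toℕ-dig-0))
    ... | false = cong x (sym (ℕ.m+[n∸m]≡n {s} {n} (ℕ.≮⇒≥ (λ n<s → subst T eq (ℕ.<⇒<ᵇ n<s)))))

  firstZero⇒digit≡0 : ∀ {x s} → firstZero p x s ≡ true → ∀ {i} → i < s → toℕ (x i) ≡ 0
  firstZero⇒digit≡0 {x} {ℕ.suc s} fz {i} i<1+s with ℕ.m≤n⇒m<n∨m≡n (ℕ.s≤s⁻¹ i<1+s)
  ... | inj₁ i<s  = firstZero⇒digit≡0 (∧-conicalʳ _ _ fz) i<s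
  ... | inj₂ refl = ℕ.≡ᵇ⇒≡ _ 0 (subst T (sym (∧-conicalˡ _ _ fz)) _)

  digit≡0⇒firstZero : ∀ {x} s → (∀ {i} → i < s → toℕ (x i) ≡ 0) → firstZero p x s ≡ true
  digit≡0⇒firstZero ℕ.zero    low≡0 = refl
  digit≡0⇒firstZero (ℕ.suc s) low≡0
    rewrite low≡0 (ℕ.n<1+n s) | digit≡0⇒firstZero s (λ i<s → low≡0 (ℕ.m<n⇒m<1+n i<s)) = refl

  firstZero-cong : ∀ s {x y} → x ≃ y → firstZero p x s ≡ firstZero p y s
  firstZero-cong ℕ.zero    x≃y = refl
  firstZero-cong (ℕ.suc s) x≃y rewrite digit-eq x≃y s | firstZero-cong s x≃y = refl

  firstZero-shiftZ : ∀ t u s → firstZero p (shiftZ p t u) (t + s) ≡ firstZero p u s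
  firstZero-shiftZ t u ℕ.zero rewrite ℕ.+-identityʳ t = digit≡0⇒firstZero t (shiftZ-low t u)
  firstZero-shiftZ t u (ℕ.suc s) rewrite ℕ.+-suc t s | shiftZ-high t u s | firstZero-shiftZ t u s = refl

  value : ℕ → Zp p → ℕ
  value ℕ.zero    x = 0
  value (ℕ.suc n) x = value n x + toℕ (x n) * p ^ n

  value-cong : ∀ n {x y} → x ≃ y → value n x ≡ value n y
  value-cong ℕ.zero    x≃y = refl
  value-cong (ℕ.suc n) x≃y = cong₂ (λ v d → v + toℕ d * p ^ n) (value-cong n x≃y) (digit-eq x≃y n)

  value<p^n : ∀ n x → value n x < p ^ n
  value<p^n ℕ.zero    x = s≤s z≤n
  value<p^n (ℕ.suc n) x = begin-strict
      value n x + d * p ^ n   <⟨ ℕ.+-monoˡ-< (d * p ^ n) (value<p^n n x) ⟩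
      ℕ.suc d * p ^ n         ≤⟨ ℕ.*-monoˡ-≤ (p ^ n) (toℕ<n (x n)) ⟩
      p * p ^ n               ∎
    where
    open ℕ.≤-Reasoning
    d = toℕ (x n)

  value-injective : ∀ {x y} → (∀ n → value n x ≡ value n y) → x ≃ y
  value-injective {x} {y} same = digitwise digits
    where
    digits : ∀ n → x n ≡ y n
    digits n = toℕ-injective (ℕ.*-cancelʳ-≡ _ _ (p ^ n) {{ℕ.m^n≢0 p n}} (ℕ.+-cancelˡ-≡ (value n x) _ _
      (trans (same (ℕ.suc n)) (cong (_+ toℕ (y n) * p ^ n) (sym (same n))))))

  value≡0⇒digit≡0 : ∀ {s x} → value s x ≡ 0 → ∀ {i} → i < s → toℕ (x i) ≡ 0
  value≡0⇒digit≡0 {ℕ.suc s} {x} v≡0 {i} i<1+s with ℕ.m≤n⇒m<n∨m≡n (ℕ.s≤s⁻¹ i<1+s)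
  ... | inj₁ i<s  = value≡0⇒digit≡0 (ℕ.m+n≡0⇒m≡0 (value s x) v≡0) i<s
  ... | inj₂ refl = ℕ.m*n≡0⇒m≡0 (toℕ (x i)) (p ^ i) {{ℕ.m^n≢0 p i}} (ℕ.m+n≡0⇒n≡0 (value s x) v≡0)

  value-+z : ∀ n x y → value n (_+z_ p x y) + addCarry p x y n * p ^ n ≡ value n x + value n y
  value-+z ℕ.zero    x y = refl
  value-+z (ℕ.suc n) x y = begin
      v + toℕ (dig p s) * P + s / p * (p * P)   ≡⟨ cong (λ d → v + d * P + s / p * (p * P)) (toℕ-dig s) ⟩
      v + s % p * P + s / p * (p * P)           ≡⟨ collect v (s % p) (s / p) p P ⟩
      v + (s % p + s / p * p) * P               ≡⟨ cong (λ t → v + t * P) (m≡m%n+[m/n]*n s p) ⟨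
      v + (dx + dy + c) * P                     ≡⟨ split v dx dy c P ⟩
      (v + c * P) + dx * P + dy * P             ≡⟨ cong (λ t → t + dx * P + dy * P) (value-+z n x y) ⟩
      (value n x + value n y) + dx * P + dy * P ≡⟨ interchange (value n x) (value n y) dx dy P ⟩
      (value n x + dx * P) + (value n y + dy * P) ∎
    where
    open Relation.Binary.PropositionalEquality.≡-Reasoning
    v = value n (_+z_ p x y)
    P = p ^ n
    dx = toℕ (x n)
    dy = toℕ (y n)
    c = addCarry p x y n
    s = dx + dy + c
    collect : ∀ v r q p P → v + r * P + q * (p * P) ≡ v + (r + q * p) * P
    collect = solve-∀
    split : ∀ v a b c P → v + (a + b + c) * P ≡ (v + c * P) + a * P + b * P
    split = solve-∀
    interchange : ∀ u w a b P → (u + w) + a * P + b * P ≡ (u + a * P) + (w + b * P)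
    interchange = solve-∀

  complement : Zp p → Zp p
  complement x n = opposite (x n)

  value-complement : ∀ n x → value n (complement x) + value n x + 1 ≡ p ^ n
  value-complement ℕ.zero    x = refl
  value-complement (ℕ.suc n) x = begin
      (v̄ + toℕ (opposite (x n)) * P) + (v + d * P) + 1
        ≡⟨ cong (λ e → (v̄ + e * P) + (v + d * P) + 1) (opposite-prop (x n)) ⟩
      (v̄ + (p ∸ ℕ.suc d) * P) + (v + d * P) + 1
        ≡⟨ regroup v̄ (p ∸ ℕ.suc d) v d P ⟩
      (v̄ + v + 1) + (p ∸ ℕ.suc d + ℕ.suc d) * P ∸ P
        ≡⟨ cong₂ (λ a b → a + b * P ∸ P) (value-complement n x) (ℕ.m∸n+n≡m (toℕ<n (x n))) ⟩
      P + p * P ∸ P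
        ≡⟨ ℕ.m+n∸m≡n P (p * P) ⟩
      p * P ∎
    where
    open Relation.Binary.PropositionalEquality.≡-Reasoning
    v̄ = value n (complement x)
    v = value n x
    d = toℕ (x n)
    P = p ^ n
    regroup : ∀ a b c d P → (a + b * P) + (c + d * P) + 1 ≡ (a + c + 1) + (b + ℕ.suc d) * P ∸ P
    regroup a b c d P = sym (trans (cong (_∸ P) (add-P a b c d P)) (ℕ.m+n∸n≡m _ P))
      where
      add-P : ∀ a b c d P → (a + c + 1) + (b + ℕ.suc d) * P ≡ ((a + b * P) + (c + d * P) + 1) + P
      add-P = solve-∀

  value-split : ∀ t s x → value (t + s) x ≡ value t x + value s (drop t x) * p ^ t
  value-split t ℕ.zero x rewrite ℕ.+-identityʳ t | ℕ.+-identityʳ (value t x) = refl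
  value-split t (ℕ.suc s) x rewrite ℕ.+-suc t s | value-split t s x | ℕ.^-distribˡ-+-* p t s =
    regroup (value t x) (p ^ t) (value s (drop t x)) (toℕ (x (t + s))) (p ^ s)
    where
    regroup : ∀ a P b d Q → a + b * P + d * (P * Q) ≡ a + (b + d * Q) * P
    regroup = solve-∀

  value-shiftZ-low : ∀ s x t → t ≤ s → value t (shiftZ p s x) ≡ 0
  value-shiftZ-low s x ℕ.zero    t≤s = refl
  value-shiftZ-low s x (ℕ.suc t) t<s
    rewrite value-shiftZ-low s x t (ℕ.<⇒≤ t<s) | shiftZ-low s x t<s = refl

  value-shiftZ : ∀ s x t → value (s + t) (shiftZ p s x) ≡ value t x * p ^ s
  value-shiftZ s x t
    rewrite value-split s t (shiftZ p s x) | value-shiftZ-low s x s ℕ.≤-refl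
          | value-cong t (drop-shiftZ s x) = refl

  sum-map-applyUpTo≡0 : ∀ (h f : ℕ → ℕ) n → (∀ i → h (f i) ≡ 0) → sum (map h (applyUpTo f n)) ≡ 0
  sum-map-applyUpTo≡0 h f ℕ.zero    h∘f≡0 = refl
  sum-map-applyUpTo≡0 h f (ℕ.suc n) h∘f≡0
    rewrite h∘f≡0 0 = sum-map-applyUpTo≡0 h (λ i → f (ℕ.suc i)) n (λ i → h∘f≡0 (ℕ.suc i))

  conv-zeroZ : ∀ y n → conv p (zeroZ p) y n ≡ 0
  conv-zeroZ y n = sum-map-applyUpTo≡0 (λ i → toℕ (zeroZ p i) * toℕ (y (n ∸ i))) (λ i → i) (ℕ.suc n)
                     (λ i → cong (_* toℕ (y (n ∸ i))) toℕ-dig-0)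

  mulCarry-zeroZ : ∀ y n → mulCarry p (zeroZ p) y n ≡ 0
  mulCarry-zeroZ y ℕ.zero    = refl
  mulCarry-zeroZ y (ℕ.suc n) = trans (cong (_/ p) (cong₂ _+_ (conv-zeroZ y n) (mulCarry-zeroZ y n))) (0/n≡0 p)

  *z-zeroˡ : ∀ y → _*z_ p (zeroZ p) y ≃ zeroZ p
  *z-zeroˡ y = digitwise λ n → cong (dig p) (cong₂ _+_ (conv-zeroZ y n) (mulCarry-zeroZ y n))

module Residues (p : ℕ) .{{_ : NonZero p}} where
  open import Data.Integer using (_+_; _*_; -_; _-_)
  open import Data.Bool using (true; false)
  open import Data.Sum using (inj₁; inj₂)
  open ℤ-Solver using (solve-∀)
  open Congruence
  open DigitStreams p

  p^ : ℕ → ℤ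
  p^ n = + (p ℕ.^ n)

  p^-+ : ∀ m n → p^ (m ℕ.+ n) ≡ p^ m * p^ n
  p^-+ m n = trans (cong +_ (ℕ.^-distribˡ-+-* p m n)) (ℤ.pos-* (p ℕ.^ m) (p ℕ.^ n))

  residue : ℕ → Zp p → ℤ
  residue n x = + value n x

  residue-cong : ∀ n {x y} → x ≃ y → residue n x ≡ residue n y
  residue-cong n x≃y = cong +_ (value-cong n x≃y)

  ≃-from-residues : ∀ {x y} → (∀ n → residue n x ≡ residue n y [mod p^ n ]) → x ≃ y
  ≃-from-residues {x} {y} same = value-injective (λ n → ≡-mod⇒≡ (value<p^n n x) (value<p^n n y) (same n))

  residue-coherent : ∀ {t n} x → t ℕ.≤ n → residue n x ≡ residue t x [mod p^ t ]
  residue-coherent {t} {n} x t≤n = subst (λ n → residue n x ≡ residue t x [mod p^ t ]) (ℕ.m+[n∸m]≡n t≤n)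
    (≡-mod-sym (+-multiple⇒≡-mod (residue (n ℕ.∸ t) (drop t x))
      (trans (sym (pos-+-* (value t x) (value (n ℕ.∸ t) (drop t x)) (p ℕ.^ t)))
             (cong +_ (sym (value-split t (n ℕ.∸ t) x))))))

  infixl 7 _mod-p^_
  _mod-p^_ : ℤ → ℕ → ℕ
  a mod-p^ n = _%ℕ_ a (p ℕ.^ n) {{ℕ.m^n≢0 p n}}

  mod-p^-≡-mod : ∀ a n → + (a mod-p^ n) ≡ a [mod p^ n ]
  mod-p^-≡-mod a n = %ℕ-≡-mod a (p ℕ.^ n) {{ℕ.m^n≢0 p n}}

  mod-p^<p^n : ∀ a n → a mod-p^ n ℕ.< p ℕ.^ n
  mod-p^<p^n a n = n%ℕd<d a (p ℕ.^ n) {{ℕ.m^n≢0 p n}}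

  p^-suc : ∀ n → p^ (ℕ.suc n) ≡ + p * p^ n
  p^-suc n = ℤ.pos-* p (p ℕ.^ n)

  residue-+z : ∀ n x y → residue n (_+z_ p x y) ≡ residue n x + residue n y [mod p^ n ]
  residue-+z n x y = +-multiple⇒≡-mod (+ c) (begin
      residue n (_+z_ p x y) + + c * p^ n   ≡⟨ pos-+-* (value n (_+z_ p x y)) c (p ℕ.^ n) ⟨
      + (value n (_+z_ p x y) ℕ.+ c ℕ.* p ℕ.^ n) ≡⟨ cong +_ (value-+z n x y) ⟩
      + (value n x ℕ.+ value n y)           ≡⟨ ℤ.pos-+ (value n x) (value n y) ⟩
      residue n x + residue n y             ∎)
    where
    open Relation.Binary.PropositionalEquality.≡-Reasoning
    c = addCarry p x y n

  residue-zeroZ : ∀ n → residue n (zeroZ p) ≡ + 0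
  residue-zeroZ ℕ.zero = refl
  residue-zeroZ (ℕ.suc n) = cong +_ (cong₂ (λ v d → v ℕ.+ d ℕ.* p ℕ.^ n) (ℤ.+-injective (residue-zeroZ n)) toℕ-dig-0)

  residue-complement : ∀ n x → residue n (complement x) ≡ - residue n x - + 1 [mod p^ n ]
  residue-complement n x = +-multiple⇒≡-mod (- + 1) (begin
      c + - + 1 * p^ n                ≡⟨ cong (λ P → c + - + 1 * P) (sym c+r+1≡p^n) ⟩
      c + - + 1 * (c + r + + 1)       ≡⟨ cancel c r ⟩
      - r - + 1                       ∎)
    where
    open Relation.Binary.PropositionalEquality.≡-Reasoning
    c = residue n (complement x)
    r = residue n x
    c+r+1≡p^n : c + r + + 1 ≡ p^ n
    c+r+1≡p^n = trans (cong (_+ + 1) (sym (ℤ.pos-+ (value n (complement x)) (value n x))))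
                  (trans (sym (ℤ.pos-+ _ 1)) (cong +_ (value-complement n x)))
    cancel : ∀ c r → c + - + 1 * (c + r + + 1) ≡ - r - + 1
    cancel = solve-∀

  residue-shiftZ : ∀ n s x → residue n (shiftZ p s x) ≡ p^ s * residue n x [mod p^ n ]
  residue-shiftZ n s x with ℕ.≤-total n s
  ... | inj₁ n≤s = +-multiple⇒≡-mod (p^ (s ℕ.∸ n) * residue n x) (begin
      residue n (shiftZ p s x) + p^ (s ℕ.∸ n) * residue n x * p^ n
        ≡⟨ cong (λ v → + v + p^ (s ℕ.∸ n) * residue n x * p^ n) (value-shiftZ-low s x n n≤s) ⟩
      + 0 + p^ (s ℕ.∸ n) * residue n x * p^ n
        ≡⟨ regroup (p^ (s ℕ.∸ n)) (residue n x) (p^ n) ⟩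
      (p^ n * p^ (s ℕ.∸ n)) * residue n x
        ≡⟨ cong (_* residue n x) (trans (sym (p^-+ n (s ℕ.∸ n))) (cong p^ (ℕ.m+[n∸m]≡n n≤s))) ⟩
      p^ s * residue n x ∎)
    where
    open Relation.Binary.PropositionalEquality.≡-Reasoning
    regroup : ∀ a r P → + 0 + a * r * P ≡ (P * a) * r
    regroup = solve-∀
  ... | inj₂ s≤n = subst (λ n → residue n (shiftZ p s x) ≡ p^ s * residue n x [mod p^ n ])
                         (ℕ.m+[n∸m]≡n s≤n) (high (n ℕ.∸ s))
    where
    high : ∀ t → residue (s ℕ.+ t) (shiftZ p s x) ≡ p^ s * residue (s ℕ.+ t) x [mod p^ (s ℕ.+ t) ]
    high t = begin
      residue (s ℕ.+ t) (shiftZ p s x)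
        ≡⟨ cong +_ (value-shiftZ s x t) ⟩
      + (value t x ℕ.* p ℕ.^ s)
        ≡⟨ trans (ℤ.pos-* (value t x) (p ℕ.^ s)) (ℤ.*-comm (residue t x) (p^ s)) ⟩
      p^ s * residue t x
        ≈⟨ ≡-mod-cong-modulus (sym (p^-+ s t))
                                             (*-cong-mod-scaled (p^ s) (residue-coherent x (ℕ.m≤n+m t s))) ⟨
      p^ s * residue (s ℕ.+ t) x        ∎
      where open ≡-mod-Reasoning (p^ (s ℕ.+ t))

  +z-cong : ∀ {x x′ y y′} → x ≃ x′ → y ≃ y′ → _+z_ p x y ≃ _+z_ p x′ y′
  +z-cong {x} {x′} {y} {y′} x≃x′ y≃y′ = ≃-from-residues λ n → let open ≡-mod-Reasoning (p^ n) in begin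
    residue n (_+z_ p x y)        ≈⟨ residue-+z n x y ⟩
    residue n x + residue n y     ≡⟨ cong₂ _+_ (residue-cong n x≃x′) (residue-cong n y≃y′) ⟩
    residue n x′ + residue n y′   ≈⟨ residue-+z n x′ y′ ⟨
    residue n (_+z_ p x′ y′)      ∎

  +z-identityʳ : ∀ x → _+z_ p x (zeroZ p) ≃ x
  +z-identityʳ x = ≃-from-residues λ n → let open ≡-mod-Reasoning (p^ n) in begin
    residue n (_+z_ p x (zeroZ p))         ≈⟨ residue-+z n x (zeroZ p) ⟩
    residue n x + residue n (zeroZ p)      ≡⟨ cong (λ r → residue n x + r) (residue-zeroZ n) ⟩
    residue n x + + 0                      ≡⟨ ℤ.+-identityʳ (residue n x) ⟩
    residue n x                            ∎

  +z-identityˡ : ∀ x → _+z_ p (zeroZ p) x ≃ x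
  +z-identityˡ x = ≃-from-residues λ n → let open ≡-mod-Reasoning (p^ n) in begin
    residue n (_+z_ p (zeroZ p) x)         ≈⟨ residue-+z n (zeroZ p) x ⟩
    residue n (zeroZ p) + residue n x      ≡⟨ cong (_+ residue n x) (residue-zeroZ n) ⟩
    + 0 + residue n x                      ≡⟨ ℤ.+-identityˡ (residue n x) ⟩
    residue n x                            ∎

  shiftZ-zeroZ : ∀ s → shiftZ p s (zeroZ p) ≃ zeroZ p
  shiftZ-zeroZ s = digitwise digits
    where
    digits : ∀ n → shiftZ p s (zeroZ p) n ≡ zeroZ p n
    digits n with n ℕ.<ᵇ s
    ... | true  = refl
    ... | false = refl

  shiftZ-+z : ∀ s x y → shiftZ p s (_+z_ p x y) ≃ _+z_ p (shiftZ p s x) (shiftZ p s y)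
  shiftZ-+z s x y = ≃-from-residues λ n → let open ≡-mod-Reasoning (p^ n) in begin
    residue n (shiftZ p s (_+z_ p x y))
      ≈⟨ residue-shiftZ n s (_+z_ p x y) ⟩
    p^ s * residue n (_+z_ p x y)
      ≈⟨ *-congˡ-mod (p^ s) (residue-+z n x y) ⟩
    p^ s * (residue n x + residue n y)
      ≡⟨ ℤ.*-distribˡ-+ (p^ s) (residue n x) (residue n y) ⟩
    p^ s * residue n x + p^ s * residue n y
      ≈⟨ +-cong-mod (residue-shiftZ n s x) (residue-shiftZ n s y) ⟨
    residue n (shiftZ p s x) + residue n (shiftZ p s y)
      ≈⟨ residue-+z n (shiftZ p s x) (shiftZ p s y) ⟨
    residue n (_+z_ p (shiftZ p s x) (shiftZ p s y)) ∎

  shiftZ-shiftZ : ∀ s t u → shiftZ p (s ℕ.+ t) u ≃ shiftZ p t (shiftZ p s u)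
  shiftZ-shiftZ s t u = ≃-from-residues λ n → let open ≡-mod-Reasoning (p^ n) in begin
    residue n (shiftZ p (s ℕ.+ t) u)
      ≈⟨ residue-shiftZ n (s ℕ.+ t) u ⟩
    p^ (s ℕ.+ t) * residue n u
      ≡⟨ cong (_* residue n u) (trans (cong p^ (ℕ.+-comm s t)) (p^-+ t s)) ⟩
    p^ t * p^ s * residue n u
      ≡⟨ ℤ.*-assoc (p^ t) (p^ s) (residue n u) ⟩
    p^ t * (p^ s * residue n u)
      ≈⟨ *-congˡ-mod (p^ t) (residue-shiftZ n s u) ⟨
    p^ t * residue n (shiftZ p s u)
      ≈⟨ residue-shiftZ n t (shiftZ p s u) ⟨
    residue n (shiftZ p t (shiftZ p s u)) ∎

  infixr 7 _·_
  _·_ : ℕ → Zp p → Zp p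
  ℕ.zero  · x = zeroZ p
  ℕ.suc k · x = _+z_ p (k · x) x

  residue-· : ∀ n k x → residue n (k · x) ≡ + k * residue n x [mod p^ n ]
  residue-· n ℕ.zero    x = ≡⇒≡-mod (trans (residue-zeroZ n) (sym (ℤ.*-zeroˡ (residue n x))))
  residue-· n (ℕ.suc k) x = begin
    residue n (ℕ.suc k · x)                ≈⟨ residue-+z n (k · x) x ⟩
    residue n (k · x) + residue n x        ≈⟨ +-congʳ-mod (residue n x) (residue-· n k x) ⟩
    + k * residue n x + residue n x        ≡⟨ collect (+ k) (residue n x) ⟩
    (+ 1 + + k) * residue n x              ≡⟨ cong (_* residue n x) (sym (ℤ.pos-+ 1 k)) ⟩
    + ℕ.suc k * residue n x                ∎
    where
    open ≡-mod-Reasoning (p^ n)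
    collect : ∀ k r → k * r + r ≡ (+ 1 + k) * r
    collect = solve-∀

module OneAndNegation (p : ℕ) .{{_ : NonZero p}} (1<p : 1 ℕ.< p) where
  open import Data.Integer using (_+_; _*_; -_; _-_)
  open import Data.Fin using (toℕ)
  open import Data.Fin.Properties using (toℕ<n; toℕ-injective)
  open import Data.Nat.DivMod using (m<n⇒m/n≡0)
  open ℤ-Solver using (solve-∀)
  open Congruence
  open DigitStreams p
  open Residues p

  value-oneZ : ∀ n → value (ℕ.suc n) (oneZ p) ≡ 1
  value-oneZ ℕ.zero    = trans (ℕ.*-identityʳ _) (toℕ-dig-< 1<p)
  value-oneZ (ℕ.suc n) = cong₂ (λ v d → v ℕ.+ d ℕ.* p ℕ.^ ℕ.suc n) (value-oneZ n) toℕ-dig-0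

  residue-oneZ : ∀ n → residue n (oneZ p) ≡ + 1 [mod p^ n ]
  residue-oneZ ℕ.zero    = +-multiple⇒≡-mod (+ 1) refl
  residue-oneZ (ℕ.suc n) = ≡⇒≡-mod (cong +_ (value-oneZ n))

  residue--z : ∀ n x → residue n (-z_ p x) ≡ - residue n x [mod p^ n ]
  residue--z n x = begin
    residue n (-z_ p x)
      ≈⟨ residue-+z n (complement x) (oneZ p) ⟩
    residue n (complement x) + residue n (oneZ p)
      ≈⟨ +-cong-mod (residue-complement n x) (residue-oneZ n) ⟩
    - residue n x - + 1 + + 1
      ≡⟨ cancel (residue n x) ⟩
    - residue n x ∎
    where
    open ≡-mod-Reasoning (p^ n)
    cancel : ∀ r → - r - + 1 + + 1 ≡ - r
    cancel = solve-∀

  fromℕ : ℕ → Zp p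
  fromℕ k = k · oneZ p

  residue-fromℕ : ∀ n k → residue n (fromℕ k) ≡ + k [mod p^ n ]
  residue-fromℕ n k = begin
    residue n (k · oneZ p)       ≈⟨ residue-· n k (oneZ p) ⟩
    + k * residue n (oneZ p)     ≈⟨ *-congˡ-mod (+ k) (residue-oneZ n) ⟩
    + k * + 1                    ≡⟨ ℤ.*-identityʳ (+ k) ⟩
    + k                          ∎
    where open ≡-mod-Reasoning (p^ n)

  conv-oneZ : ∀ y n → conv p (oneZ p) y n ≡ toℕ (y n)
  conv-oneZ y n
    rewrite sum-map-applyUpTo≡0 (λ i → toℕ (oneZ p i) ℕ.* toℕ (y (n ℕ.∸ i))) ℕ.suc n
              (λ i → cong (ℕ._* toℕ (y (n ℕ.∸ ℕ.suc i))) toℕ-dig-0)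
          | toℕ-dig-< 1<p = trans (ℕ.+-identityʳ _) (ℕ.*-identityˡ _)

  mulCarry-oneZ : ∀ y n → mulCarry p (oneZ p) y n ≡ 0
  mulCarry-oneZ y ℕ.zero    = refl
  mulCarry-oneZ y (ℕ.suc n)
    rewrite conv-oneZ y n | mulCarry-oneZ y n | ℕ.+-identityʳ (toℕ (y n)) = m<n⇒m/n≡0 (toℕ<n (y n))

  *z-identityˡ : ∀ y → _*z_ p (oneZ p) y ≃ y
  *z-identityˡ y = digitwise λ n → toℕ-injective (begin
    toℕ (dig p (conv p (oneZ p) y n ℕ.+ mulCarry p (oneZ p) y n))
      ≡⟨ cong (λ k → toℕ (dig p k)) (cong₂ ℕ._+_ (conv-oneZ y n) (mulCarry-oneZ y n)) ⟩
    toℕ (dig p (toℕ (y n) ℕ.+ 0))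
      ≡⟨ toℕ-dig-< (subst (ℕ._< p) (sym (ℕ.+-identityʳ _)) (toℕ<n (y n))) ⟩
    toℕ (y n) ℕ.+ 0
      ≡⟨ ℕ.+-identityʳ _ ⟩
    toℕ (y n) ∎)
    where open Relation.Binary.PropositionalEquality.≡-Reasoning

  ≡-mod⇒InCoset : ∀ {a x} s → residue s x ≡ residue s a [mod p^ s ] → InCoset p s a x
  ≡-mod⇒InCoset {a} {x} s x≡a = drop s d , digit-eq x≃a+shifted
    where
    d = _+z_ p x (-z_ p a)
    d≡0 : residue s d ≡ + 0 [mod p^ s ]
    d≡0 = begin
      residue s d                        ≈⟨ residue-+z s x (-z_ p a) ⟩
      residue s x + residue s (-z_ p a)  ≈⟨ +-cong-mod x≡a (residue--z s a) ⟩
      residue s a - residue s a          ≡⟨ ℤ.+-inverseʳ (residue s a) ⟩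
      + 0                                ∎
      where open ≡-mod-Reasoning (p^ s)
    d≃shifted : d ≃ shiftZ p s (drop s d)
    d≃shifted = low-digits≡0⇒≃shiftZ s (value≡0⇒digit≡0 (≡-mod⇒≡ (value<p^n s d) (ℕ.m^n>0 p s) d≡0))
    x≃a+shifted : x ≃ _+z_ p a (shiftZ p s (drop s d))
    x≃a+shifted = ≃-from-residues λ n → let open ≡-mod-Reasoning (p^ n) in begin
      residue n x
        ≡⟨ regroup (residue n a) (residue n x) ⟩
      residue n a + (residue n x + - residue n a)
        ≈⟨ +-congˡ-mod (residue n a) (+-congˡ-mod (residue n x) (residue--z n a)) ⟨
      residue n a + (residue n x + residue n (-z_ p a))
        ≈⟨ +-congˡ-mod (residue n a) (residue-+z n x (-z_ p a)) ⟨
      residue n a + residue n d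
        ≡⟨ cong (λ r → residue n a + r) (residue-cong n d≃shifted) ⟩
      residue n a + residue n (shiftZ p s (drop s d))
        ≈⟨ residue-+z n a (shiftZ p s (drop s d)) ⟨
      residue n (_+z_ p a (shiftZ p s (drop s d))) ∎
      where
      regroup : ∀ a x → x ≡ a + (x + - a)
      regroup = solve-∀

module CoherentLimits (p : ℕ) .{{_ : NonZero p}} where
  open import Data.Integer using (_+_; _*_; -_; _-_)
  open import Data.Fin using (toℕ)
  open ℤ-Solver using (solve-∀)
  open Congruence
  open DigitStreams p
  open Residues p

  module _ (T : ℕ → ℕ) (T<p^n : ∀ n → T n ℕ.< p ℕ.^ n)
           (coherent : ∀ n → + T (ℕ.suc n) ≡ + T n [mod p^ n ]) where

    limit : Zp p
    limit n = dig p (ℕ._/_ (T (ℕ.suc n)) (p ℕ.^ n) {{ℕ.m^n≢0 p n}})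

    value-limit : ∀ n → value n limit ≡ T n
    value-limit ℕ.zero    = sym (ℕ.n<1⇒n≡0 (T<p^n 0))
    value-limit (ℕ.suc n) = begin
      value n limit ℕ.+ toℕ (limit n) ℕ.* P
        ≡⟨ cong₂ (λ v d → v ℕ.+ d ℕ.* P) (value-limit n) (toℕ-dig-< digit<p) ⟩
      T n ℕ.+ T′ ℕ./ P ℕ.* P
        ≡⟨ cong (ℕ._+ T′ ℕ./ P ℕ.* P) lower-digits ⟨
      T′ ℕ.% P ℕ.+ T′ ℕ./ P ℕ.* P
        ≡⟨ ℕ.m≡m%n+[m/n]*n T′ P ⟨
      T′ ∎
      where
      open Relation.Binary.PropositionalEquality.≡-Reasoning
      P = p ℕ.^ n
      T′ = T (ℕ.suc n)
      instance
        P≢0 : NonZero P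
        P≢0 = ℕ.m^n≢0 p n
      digit<p : T′ ℕ./ P ℕ.< p
      digit<p = ℕ.m<n*o⇒m/o<n (T<p^n (ℕ.suc n))
      lower-digits : T′ ℕ.% P ≡ T n
      lower-digits = ≡-mod⇒≡ (ℕ.m%n<n T′ P) (T<p^n n) (≡-mod-trans (%-≡-mod T′ P) (coherent n))

  module _ (c : ℕ) (R : Zp p) where
    private
      k : ℤ
      k = + p * + c

    -- Lifting approx n to a solution modulo p^(n+1) changes it by a multiple of p^n,
    -- which k = p c turns into a multiple of p^(n+1).
    approx : ℕ → ℕ
    approx ℕ.zero    = 0
    approx (ℕ.suc n) = (residue (ℕ.suc n) R - k * + approx n) mod-p^ ℕ.suc n

    approx<p^n : ∀ n → approx n ℕ.< p ℕ.^ n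
    approx<p^n ℕ.zero    = ℕ.s≤s ℕ.z≤n
    approx<p^n (ℕ.suc n) = mod-p^<p^n (residue (ℕ.suc n) R - k * + approx n) (ℕ.suc n)

    Solves : ℕ → Set
    Solves n = (+ 1 + k) * + approx n ≡ residue n R [mod p^ n ]

    approx-coherent : ∀ n → Solves n → + approx (ℕ.suc n) ≡ + approx n [mod p^ n ]
    approx-coherent n solves = begin
      + approx (ℕ.suc n)
        ≈⟨ ≡-mod-weaken (+ p) (≡-mod-cong-modulus (p^-suc n) (mod-p^-≡-mod (R′ - k * + A) (ℕ.suc n))) ⟩
      R′ - k * + A
        ≈⟨ +-congʳ-mod (- (k * + A)) (residue-coherent R (ℕ.n≤1+n n)) ⟩
      residue n R - k * + A
        ≈⟨ +-congʳ-mod (- (k * + A)) solves ⟨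
      (+ 1 + k) * + A - k * + A
        ≡⟨ cancel k (+ A) ⟩
      + A ∎
      where
      open ≡-mod-Reasoning (p^ n)
      A = approx n
      R′ = residue (ℕ.suc n) R
      cancel : ∀ k a → (+ 1 + k) * a - k * a ≡ a
      cancel = solve-∀

    approx-solves : ∀ n → Solves n
    approx-solves ℕ.zero    = ≡-mod-1 _ _
    approx-solves (ℕ.suc n) = begin
      (+ 1 + k) * + A′
        ≡⟨ expand k (+ A′) ⟩
      + A′ + k * + A′
        ≈⟨ +-congʳ-mod (k * + A′) (mod-p^-≡-mod (R′ - k * + A) (ℕ.suc n)) ⟩
      (R′ - k * + A) + k * + A′
        ≡⟨ regroup R′ (+ p) (+ c) (+ A) (+ A′) ⟩
      R′ + + c * (+ p * (+ A′ - + A))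
        ≈⟨ +-congˡ-mod R′ (*-congˡ-mod (+ c) p[A′-A]≡0) ⟩
      R′ + + c * (+ p * + 0)
        ≡⟨ vanish R′ (+ c) (+ p) ⟩
      R′ ∎
      where
      open ≡-mod-Reasoning (p^ (ℕ.suc n))
      A = approx n
      A′ = approx (ℕ.suc n)
      R′ = residue (ℕ.suc n) R
      expand : ∀ k a → (+ 1 + k) * a ≡ a + k * a
      expand = solve-∀
      regroup : ∀ r p c a a′ → (r - p * c * a) + p * c * a′ ≡ r + c * (p * (a′ - a))
      regroup = solve-∀
      vanish : ∀ r c p → r + c * (p * + 0) ≡ r
      vanish = solve-∀
      A′-A≡0 : + A′ - + A ≡ + 0 [mod p^ n ]
      A′-A≡0 = ≡-mod-trans (+-congʳ-mod (- + A) (approx-coherent n (approx-solves n))) (≡⇒≡-mod (ℤ.+-inverseʳ (+ A)))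
      p[A′-A]≡0 : + p * (+ A′ - + A) ≡ + p * + 0 [mod p^ (ℕ.suc n) ]
      p[A′-A]≡0 = ≡-mod-cong-modulus (sym (p^-suc n)) (*-cong-mod-scaled (+ p) A′-A≡0)

    1+p*c·-surjective : Σ (Zp p) (λ x → ℕ.suc (p ℕ.* c) · x ≃ R)
    1+p*c·-surjective = x , ≃-from-residues λ n → let open ≡-mod-Reasoning (p^ n) in begin
      residue n (ℕ.suc (p ℕ.* c) · x)
        ≈⟨ residue-· n (ℕ.suc (p ℕ.* c)) x ⟩
      + ℕ.suc (p ℕ.* c) * residue n x
        ≡⟨ cong₂ _*_ (trans (ℤ.pos-+ 1 (p ℕ.* c)) (cong (λ t → + 1 + t) (ℤ.pos-* p c)))
                                                         (cong +_ (value-limit approx approx<p^n coherent n)) ⟩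
      (+ 1 + k) * + approx n
        ≈⟨ approx-solves n ⟩
      residue n R ∎
      where
      coherent : ∀ n → + approx (ℕ.suc n) ≡ + approx n [mod p^ n ]
      coherent n = approx-coherent n (approx-solves n)
      x = limit approx approx<p^n coherent

module PAdicNumbers (p : ℕ) .{{_ : NonZero p}} where
  open import Data.Integer using (_+_; _-_; _⊓_)
  open import Relation.Binary.PropositionalEquality using (subst₂)
  open import Data.Bool using (true; false; if_then_else_)
  open import Data.Sum using (inj₁; inj₂)
  open ℤ-Solver using (solve-∀)
  open DigitStreams p
  open Residues p

  infix 4 _≈q_
  record _≈q_ (a b : Qp p) : Set where
    constructor aligned
    field aligned-eq : proj₁ (align p a b) ≃ proj₂ (align p a b)
  open _≈q_ public

  ≈q⇒≈ : ∀ {a b} → a ≈q b → _≈_ p a b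
  ≈q⇒≈ a≈b = digit-eq (aligned-eq a≈b)

  ≈q-refl : ∀ {a} → a ≈q a
  ≈q-refl = aligned ≃-refl

  -- p^K · a, a p-adic integer as soon as ∣ expo a ∣ ≤ K.
  scaled : ℕ → Qp p → Zp p
  scaled K a = shiftZ p (∣ expo a + + K ∣) (unit a)

  exponent+K : ∀ e K → ∣ e ∣ ℕ.≤ K → Σ ℕ (λ t → e + + K ≡ + t)
  exponent+K (+ n)    K _     = n ℕ.+ K , refl
  exponent+K -[1+ n ] K n<K   = K ℕ.∸ ℕ.suc n , ℤ.⊖-≥ n<K

  ∣⊓∣≤ : ∀ {i j K} → ∣ i ∣ ℕ.≤ K → ∣ j ∣ ℕ.≤ K → ∣ i ⊓ j ∣ ℕ.≤ K
  ∣⊓∣≤ {i} {j} ∣i∣≤K ∣j∣≤K with ℤ.⊓-sel i j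
  ... | inj₁ i⊓j≡i = subst (λ e → ∣ e ∣ ℕ.≤ _) (sym i⊓j≡i) ∣i∣≤K
  ... | inj₂ i⊓j≡j = subst (λ e → ∣ e ∣ ℕ.≤ _) (sym i⊓j≡j) ∣j∣≤K

  +K-via-lower : ∀ {k μ K t} → μ ℤ.≤ k → μ + + K ≡ + t → k + + K ≡ + (∣ k - μ ∣ ℕ.+ t)
  +K-via-lower {k} {μ} {K} {t} μ≤k μ+K≡t = begin
    k + + K                 ≡⟨ split k μ (+ K) ⟩
    (k - μ) + (μ + + K)     ≡⟨ cong₂ _+_ (sym (ℤ.0≤i⇒+∣i∣≡i (ℤ.i≤j⇒0≤j-i μ≤k))) μ+K≡t ⟩
    + ∣ k - μ ∣ + + t       ≡⟨ ℤ.pos-+ ∣ k - μ ∣ t ⟨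
    + (∣ k - μ ∣ ℕ.+ t)     ∎
    where
    open Relation.Binary.PropositionalEquality.≡-Reasoning
    split : ∀ k μ K → k + K ≡ (k - μ) + (μ + K)
    split = solve-∀

  shiftZ-via-lower : ∀ {k μ K} u → μ ℤ.≤ k → ∣ μ ∣ ℕ.≤ K →
    shiftZ p (∣ k + + K ∣) u ≃ shiftZ p (∣ μ + + K ∣) (shiftZ p (∣ k - μ ∣) u)
  shiftZ-via-lower {k} {μ} {K} u μ≤k ∣μ∣≤K with exponent+K μ K ∣μ∣≤K
  ... | t , μ+K≡t rewrite μ+K≡t | +K-via-lower μ≤k μ+K≡t = shiftZ-shiftZ ∣ k - μ ∣ t u

  module _ {K} (a b : Qp p) (∣a∣≤K : ∣ expo a ∣ ℕ.≤ K) (∣b∣≤K : ∣ expo b ∣ ℕ.≤ K) where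
    private
      t : ℕ
      t = ∣ expo a ⊓ expo b + + K ∣

      ∣a⊓b∣≤K : ∣ expo a ⊓ expo b ∣ ℕ.≤ K
      ∣a⊓b∣≤K = ∣⊓∣≤ {expo a} {expo b} ∣a∣≤K ∣b∣≤K

      scaled-align₁ : scaled K a ≃ shiftZ p t (proj₁ (align p a b))
      scaled-align₁ = shiftZ-via-lower (unit a) (ℤ.i⊓j≤i (expo a) (expo b)) ∣a⊓b∣≤K

      scaled-align₂ : scaled K b ≃ shiftZ p t (proj₂ (align p a b))
      scaled-align₂ = shiftZ-via-lower (unit b) (ℤ.i⊓j≤j (expo a) (expo b)) ∣a⊓b∣≤K

    ≈q⇒scaled≃ : a ≈q b → scaled K a ≃ scaled K b
    ≈q⇒scaled≃ a≈b = ≃-trans scaled-align₁ (≃-trans (shiftZ-cong t (aligned-eq a≈b)) (≃-sym scaled-align₂))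

    scaled≃⇒≈q : scaled K a ≃ scaled K b → a ≈q b
    scaled≃⇒≈q Ka≃Kb = aligned (begin
      proj₁ (align p a b)
        ≈⟨ drop-shiftZ t _ ⟨
      drop t (shiftZ p t (proj₁ (align p a b)))
        ≈⟨ drop-cong t (≃-trans (≃-sym scaled-align₁) (≃-trans Ka≃Kb scaled-align₂)) ⟩
      drop t (shiftZ p t (proj₂ (align p a b)))
        ≈⟨ drop-shiftZ t _ ⟩
      proj₂ (align p a b) ∎)
      where open ≃-Reasoning

    scaled-+q : scaled K (_+q_ p a b) ≃ _+z_ p (scaled K a) (scaled K b)
    scaled-+q = ≃-trans (shiftZ-+z t _ _) (+z-cong (≃-sym scaled-align₁) (≃-sym scaled-align₂))

    ∣+q∣≤ : ∣ expo (_+q_ p a b) ∣ ℕ.≤ K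
    ∣+q∣≤ = ∣a⊓b∣≤K

  ≈q-sym : ∀ {a b} → a ≈q b → b ≈q a
  ≈q-sym {a} {b} a≈b =
    scaled≃⇒≈q b a (ℕ.m≤n⊔m _ _) (ℕ.m≤m⊔n _ _) (≃-sym (≈q⇒scaled≃ a b (ℕ.m≤m⊔n _ _) (ℕ.m≤n⊔m _ _) a≈b))

  ≈q-trans : ∀ {a b c} → a ≈q b → b ≈q c → a ≈q c
  ≈q-trans {a} {b} {c} a≈b b≈c =
    scaled≃⇒≈q a c ∣a∣≤K ∣c∣≤K (≃-trans (≈q⇒scaled≃ a b ∣a∣≤K ∣b∣≤K a≈b) (≈q⇒scaled≃ b c ∣b∣≤K ∣c∣≤K b≈c))
    where
    K = ∣ expo a ∣ ℕ.⊔ ∣ expo b ∣ ℕ.⊔ ∣ expo c ∣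
    ∣a∣≤K = ℕ.≤-trans (ℕ.m≤m⊔n _ _) (ℕ.m≤m⊔n _ _)
    ∣b∣≤K = ℕ.≤-trans (ℕ.m≤n⊔m ∣ expo a ∣ _) (ℕ.m≤m⊔n _ _)
    ∣c∣≤K = ℕ.m≤n⊔m _ ∣ expo c ∣

  +q-cong : ∀ {a a′ b b′} → a ≈q a′ → b ≈q b′ → _+q_ p a b ≈q _+q_ p a′ b′
  +q-cong {a} {a′} {b} {b′} a≈a′ b≈b′ =
    scaled≃⇒≈q (_+q_ p a b) (_+q_ p a′ b′) (∣+q∣≤ a b ∣a∣≤K ∣b∣≤K) (∣+q∣≤ a′ b′ ∣a′∣≤K ∣b′∣≤K) (begin
      scaled K (_+q_ p a b)
        ≈⟨ scaled-+q a b ∣a∣≤K ∣b∣≤K ⟩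
      _+z_ p (scaled K a) (scaled K b)
        ≈⟨ +z-cong (≈q⇒scaled≃ a a′ ∣a∣≤K ∣a′∣≤K a≈a′) (≈q⇒scaled≃ b b′ ∣b∣≤K ∣b′∣≤K b≈b′) ⟩
      _+z_ p (scaled K a′) (scaled K b′)
        ≈⟨ scaled-+q a′ b′ ∣a′∣≤K ∣b′∣≤K ⟨
      scaled K (_+q_ p a′ b′) ∎)
    where
    open ≃-Reasoning
    K = (∣ expo a ∣ ℕ.⊔ ∣ expo a′ ∣) ℕ.⊔ (∣ expo b ∣ ℕ.⊔ ∣ expo b′ ∣)
    ∣a∣≤K = ℕ.≤-trans (ℕ.m≤m⊔n _ _) (ℕ.m≤m⊔n _ _)
    ∣a′∣≤K = ℕ.≤-trans (ℕ.m≤n⊔m ∣ expo a ∣ _) (ℕ.m≤m⊔n _ _)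
    ∣b∣≤K = ℕ.≤-trans (ℕ.m≤m⊔n _ _) (ℕ.m≤n⊔m (∣ expo a ∣ ℕ.⊔ ∣ expo a′ ∣) _)
    ∣b′∣≤K = ℕ.≤-trans (ℕ.m≤n⊔m ∣ expo b ∣ _) (ℕ.m≤n⊔m (∣ expo a ∣ ℕ.⊔ ∣ expo a′ ∣) _)

  inZp-scaled : ∀ {K} a → ∣ expo a ∣ ℕ.≤ K → inZp p a ≡ firstZero p (scaled K a) K
  inZp-scaled {K} (u ∙p^ (+ n)) _ =
    sym (digit≡0⇒firstZero K (λ i<K → shiftZ-low (n ℕ.+ K) u (ℕ.≤-trans i<K (ℕ.m≤n+m K n))))
  inZp-scaled {K} (u ∙p^ -[1+ n ]) n<K = sym (begin
    firstZero p (shiftZ p (∣ -[1+ n ] + + K ∣) u) K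
      ≡⟨ cong (λ e → firstZero p (shiftZ p ∣ e ∣ u) K) (ℤ.⊖-≥ n<K) ⟩
    firstZero p (shiftZ p (K ℕ.∸ ℕ.suc n) u) K
      ≡⟨ cong (firstZero p (shiftZ p (K ℕ.∸ ℕ.suc n) u)) (ℕ.m∸n+n≡m n<K) ⟨
    firstZero p (shiftZ p (K ℕ.∸ ℕ.suc n) u) (K ℕ.∸ ℕ.suc n ℕ.+ ℕ.suc n)
      ≡⟨ firstZero-shiftZ (K ℕ.∸ ℕ.suc n) u (ℕ.suc n) ⟩
    firstZero p u (ℕ.suc n) ∎)
    where open Relation.Binary.PropositionalEquality.≡-Reasoning

  inZp-cong : ∀ {a b} → a ≈q b → inZp p a ≡ inZp p b
  inZp-cong {a} {b} a≈b = begin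
    inZp p a                     ≡⟨ inZp-scaled a ∣a∣≤K ⟩
    firstZero p (scaled K a) K   ≡⟨ firstZero-cong K (≈q⇒scaled≃ a b ∣a∣≤K ∣b∣≤K a≈b) ⟩
    firstZero p (scaled K b) K   ≡⟨ inZp-scaled b ∣b∣≤K ⟨
    inZp p b                     ∎
    where
    open Relation.Binary.PropositionalEquality.≡-Reasoning
    K = ∣ expo a ∣ ℕ.⊔ ∣ expo b ∣
    ∣a∣≤K = ℕ.m≤m⊔n ∣ expo a ∣ ∣ expo b ∣
    ∣b∣≤K = ℕ.m≤n⊔m ∣ expo a ∣ ∣ expo b ∣

  pReLU-cong : ∀ {a b} → a ≈q b → pReLU p a ≈q pReLU p b
  pReLU-cong {a} {b} a≈b with inZp p a | inZp p b | inZp-cong a≈b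
  ... | true  | true  | refl = a≈b
  ... | false | false | refl = ≈q-refl

  ≡⇒≈q : ∀ {a b} → a ≡ b → a ≈q b
  ≡⇒≈q refl = ≈q-refl

  ≃⇒≈q : ∀ {u v} k → u ≃ v → (u ∙p^ k) ≈q (v ∙p^ k)
  ≃⇒≈q k u≃v = aligned (shiftZ-cong ∣ k - k ⊓ k ∣ u≃v)

  zeroZ-≈q : ∀ {u v} k j → u ≃ zeroZ p → v ≃ zeroZ p → (u ∙p^ k) ≈q (v ∙p^ j)
  zeroZ-≈q k j u≃0 v≃0 = aligned (≃-trans (zero-shifted ∣ k - k ⊓ j ∣ u≃0) (≃-sym (zero-shifted ∣ j - k ⊓ j ∣ v≃0)))
    where
    zero-shifted : ∀ s {w} → w ≃ zeroZ p → shiftZ p s w ≃ zeroZ p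
    zero-shifted s w≃0 = ≃-trans (shiftZ-cong s w≃0) (shiftZ-zeroZ s)

  +q-same-exponent : ∀ {a b u v} e → a ≈q (u ∙p^ e) → b ≈q (v ∙p^ e) → _+q_ p a b ≈q (_+z_ p u v ∙p^ e)
  +q-same-exponent {u = u} {v} e a≈ b≈ = ≈q-trans (+q-cong a≈ b≈) (≈q-trans
    (≃⇒≈q (e ⊓ e) (+z-cong (unshift u) (unshift v)))
    (≡⇒≈q (cong (_+z_ p u v ∙p^_) (ℤ.⊓-idem e))))
    where
    unshift : ∀ w → shiftZ p ∣ e - e ⊓ e ∣ w ≃ w
    unshift w = ≡⇒≃ (cong (λ d → shiftZ p ∣ d ∣ w) (trans (cong (e -_) (ℤ.⊓-idem e)) (ℤ.+-inverseʳ e)))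

  ≈q-+exponent : ∀ {u v k j} e → (u ∙p^ k) ≈q (v ∙p^ j) → (u ∙p^ (e + k)) ≈q (v ∙p^ (e + j))
  ≈q-+exponent {u} {v} {k} {j} e (aligned u≃v) = aligned (subst₂ (λ s t → shiftZ p s u ≃ shiftZ p t v)
    (cong ∣_∣ (sym (offset-cancels k))) (cong ∣_∣ (sym (offset-cancels j))) u≃v)
    where
    offset-cancels : ∀ i → (e + i) - ((e + k) ⊓ (e + j)) ≡ i - (k ⊓ j)
    offset-cancels i = trans (cong ((e + i) -_) (sym (ℤ.mono-≤-distrib-⊓ (ℤ.+-monoʳ-≤ e) k j))) (cancel e i (k ⊓ j))
      where
      cancel : ∀ e i m → (e + i) - (e + m) ≡ i - m
      cancel = solve-∀

  pReLU-p^-[1+m] : ∀ m y →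
    pReLU p (y ∙p^ -[1+ m ]) ≈q ι p (if firstZero p y (ℕ.suc m) then drop (ℕ.suc m) y else zeroZ p)
  pReLU-p^-[1+m] m y with firstZero p y (ℕ.suc m) in fz
  ... | false = ≈q-refl
  ... | true  = scaled≃⇒≈q (y ∙p^ -[1+ m ]) (ι p (drop (ℕ.suc m) y)) ℕ.≤-refl ℕ.z≤n (begin
    shiftZ p (∣ -[1+ m ] + + ℕ.suc m ∣) y
      ≡⟨ cong (λ e → shiftZ p ∣ e ∣ y) (trans (ℤ.[1+m]⊖[1+n]≡m⊖n m m) (ℤ.n⊖n≡0 m)) ⟩
    shiftZ p 0 y
      ≈⟨ digitwise (λ _ → refl) ⟩
    y
      ≈⟨ low-digits≡0⇒≃shiftZ (ℕ.suc m) (firstZero⇒digit≡0 fz) ⟩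
    shiftZ p (ℕ.suc m) (drop (ℕ.suc m) y) ∎)
    where open ≃-Reasoning

  zeroZ-*q : ∀ e a → _*q_ p (zeroZ p ∙p^ e) a ≈q (zeroZ p ∙p^ e)
  zeroZ-*q e a = zeroZ-≈q _ e (*z-zeroˡ (unit a)) ≃-refl

  sumZ : ∀ {d} → (Fin d → Zp p) → Zp p
  sumZ {ℕ.zero}  u = zeroZ p
  sumZ {ℕ.suc d} u = _+z_ p (u zero) (sumZ (λ j → u (suc j)))

  sumq-same-exponent : ∀ {d} e (f : Vecq p d) (u : Fin d → Zp p) →
    (∀ j → f j ≈q (u j ∙p^ e)) → sumq p f ≈q (sumZ u ∙p^ e)
  sumq-same-exponent {ℕ.zero}  e f u f≈u = zeroZ-≈q (+ 0) e ≃-refl ≃-refl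
  sumq-same-exponent {ℕ.suc d} e f u f≈u =
    +q-same-exponent e (f≈u zero) (sumq-same-exponent e (λ j → f (suc j)) (λ j → u (suc j)) (λ j → f≈u (suc j)))

  applyAffine-same-exponent : ∀ {a b} (t : Affine p a b) X i e {β} (u : Fin a → Zp p) →
    Affine.bias t i ≈q (β ∙p^ e) → (∀ j → _*q_ p (Affine.matrix t i j) (X j) ≈q (u j ∙p^ e)) →
    applyAffine p t X i ≈q (_+z_ p β (sumZ u) ∙p^ e)
  applyAffine-same-exponent t X i e u bias≈ terms≈ =
    +q-same-exponent e bias≈ (sumq-same-exponent e _ u terms≈)

module Steps (p : ℕ) .{{_ : NonZero p}} (1<p : 1 ℕ.< p) (m : ℕ) where
  open import Data.Bool using (if_then_else_)
  open DigitStreams p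
  open OneAndNegation p 1<p

  offset : ℕ → Zp p → Zp p → Zp p
  offset k x w = _+z_ p (-z_ p (fromℕ k)) (_+z_ p x w)

  -- The second neuron of hidden layer k: w ↦ pReLU(p^-(m+1) (x + w - k)), read in ℤ_p.
  step : ℕ → Zp p → Zp p → Zp p
  step k x w = if firstZero p (offset k x w) (ℕ.suc m) then drop (ℕ.suc m) (offset k x w) else zeroZ p

  run : ℕ → ℕ → Zp p → Zp p → Zp p
  run k ℕ.zero    x w = w
  run k (ℕ.suc n) x w = run (ℕ.suc k) n x (step k x w)

module Network (p : ℕ) .{{_ : NonZero p}} (1<p : 1 ℕ.< p) (m : ℕ) where
  open import Data.Integer using (_+_)
  open DigitStreams p
  open Residues p
  open OneAndNegation p 1<p
  open PAdicNumbers p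
  open Steps p 1<p m

  1q : Qp p
  1q = ι p (oneZ p)

  p^-[1+m] : Qp p
  p^-[1+m] = oneZ p ∙p^ -[1+ m ]

  inputLayer : Affine p 1 2
  inputLayer = record
    { matrix = λ { zero _ → 1q ; (suc _) _ → 0q p }
    ; bias   = λ _ → 0q p }

  hiddenLayer : ℕ → Affine p 2 2
  hiddenLayer k = record
    { matrix = λ { zero zero → 1q ; zero (suc _) → 0q p ; (suc _) _ → p^-[1+m] }
    ; bias   = λ { zero → 0q p ; (suc _) → -z_ p (fromℕ k) ∙p^ -[1+ m ] } }

  outputLayer : Affine p 2 2
  outputLayer = record
    { matrix = λ { zero zero → 1q ; (suc _) (suc _) → 1q ; _ _ → 0q p }
    ; bias   = λ _ → 0q p }

  layers : ℕ → ℕ → Net p 2 2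
  layers k ℕ.zero    = output outputLayer
  layers k (ℕ.suc n) = hidden (hiddenLayer k) (layers (ℕ.suc k) n)

  network : ℕ → Net p 1 2
  network n = hidden inputLayer (layers 0 n)

  width-network : ∀ n → width p (network n) ≡ 2
  width-network n = width-layers 0 n
    where
    width-layers : ∀ k n → 2 ℕ.⊔ width p (layers k n) ≡ 2
    width-layers k ℕ.zero    = refl
    width-layers k (ℕ.suc n) rewrite width-layers (ℕ.suc k) n = refl

  oneZ-*q : ∀ e {a x} → a ≈q ι p x → _*q_ p (oneZ p ∙p^ e) a ≈q (x ∙p^ e)
  oneZ-*q e {a} {x} a≈x = ≈q-trans (≃⇒≈q (e + expo a) (*z-identityˡ (unit a)))
                                     (≈q-trans (≈q-+exponent e a≈x) (≡⇒≈q (cong (x ∙p^_) (ℤ.+-identityʳ e))))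

  private
    0+[x+0]≃x : ∀ x → _+z_ p (zeroZ p) (_+z_ p x (zeroZ p)) ≃ x
    0+[x+0]≃x x = ≃-trans (+z-identityˡ _) (+z-identityʳ x)

    0+[x+[0+0]]≃x : ∀ x → _+z_ p (zeroZ p) (_+z_ p x (_+z_ p (zeroZ p) (zeroZ p))) ≃ x
    0+[x+[0+0]]≃x x = ≃-trans (+z-cong ≃-refl (+z-cong ≃-refl (+z-identityʳ _))) (0+[x+0]≃x x)

    0+[0+[w+0]]≃w : ∀ w → _+z_ p (zeroZ p) (_+z_ p (zeroZ p) (_+z_ p w (zeroZ p))) ≃ w
    0+[0+[w+0]]≃w w = ≃-trans (+z-identityˡ _) (≃-trans (+z-identityˡ _) (+z-identityʳ w))

  eval-layers : ∀ k n X {x w} → X zero ≈q ι p x → X (suc zero) ≈q ι p w →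
    (eval p (layers k n) X zero ≈q ι p x) × (eval p (layers k n) X (suc zero) ≈q ι p (run k n x w))
  eval-layers k ℕ.zero X {x} {w} x≈ w≈ =
      ≈q-trans (applyAffine-same-exponent outputLayer X zero (+ 0) (λ { zero → x ; (suc _) → zeroZ p }) ≈q-refl
                  (λ { zero → oneZ-*q (+ 0) x≈ ; (suc zero) → zeroZ-*q (+ 0) (X (suc zero)) }))
               (≃⇒≈q (+ 0) (0+[x+[0+0]]≃x x))
    , ≈q-trans (applyAffine-same-exponent outputLayer X (suc zero) (+ 0) (λ { zero → zeroZ p ; (suc _) → w }) ≈q-refl
                  (λ { zero → zeroZ-*q (+ 0) (X zero) ; (suc zero) → oneZ-*q (+ 0) w≈ }))
               (≃⇒≈q (+ 0) (0+[0+[w+0]]≃w w))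
  eval-layers k (ℕ.suc n) X {x} {w} x≈ w≈ =
    eval-layers (ℕ.suc k) n _ (pReLU-cong x-row) (≈q-trans (pReLU-cong w-row) (pReLU-p^-[1+m] m (offset k x w)))
    where
    x-row : applyAffine p (hiddenLayer k) X zero ≈q ι p x
    x-row = ≈q-trans (applyAffine-same-exponent (hiddenLayer k) X zero (+ 0) (λ { zero → x ; (suc _) → zeroZ p }) ≈q-refl
                       (λ { zero → oneZ-*q (+ 0) x≈ ; (suc zero) → zeroZ-*q (+ 0) (X (suc zero)) }))
                     (≃⇒≈q (+ 0) (0+[x+[0+0]]≃x x))
    w-row : applyAffine p (hiddenLayer k) X (suc zero) ≈q (offset k x w ∙p^ -[1+ m ])
    w-row = ≈q-trans (applyAffine-same-exponent (hiddenLayer k) X (suc zero) -[1+ m ] (λ { zero → x ; (suc _) → w }) ≈q-refl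
                       (λ { zero → oneZ-*q -[1+ m ] x≈ ; (suc zero) → oneZ-*q -[1+ m ] w≈ }))
                     (≃⇒≈q -[1+ m ] (+z-cong ≃-refl (+z-cong ≃-refl (+z-identityʳ w))))

  eval-network : ∀ n x → (eval p (network n) (λ _ → ι p x) zero ≈q ι p x)
                       × (eval p (network n) (λ _ → ι p x) (suc zero) ≈q ι p (run 0 n x (zeroZ p)))
  eval-network n x = eval-layers 0 n _ (pReLU-cong x-row) (pReLU-cong 0-row)
    where
    x-row : applyAffine p inputLayer (λ _ → ι p x) zero ≈q ι p x
    x-row = ≈q-trans (applyAffine-same-exponent inputLayer (λ _ → ι p x) zero (+ 0) (λ _ → x) ≈q-refl
                       (λ { zero → oneZ-*q (+ 0) ≈q-refl }))
                     (≃⇒≈q (+ 0) (0+[x+0]≃x x))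
    0-row : applyAffine p inputLayer (λ _ → ι p x) (suc zero) ≈q ι p (zeroZ p)
    0-row = ≈q-trans (applyAffine-same-exponent inputLayer (λ _ → ι p x) (suc zero) (+ 0) (λ _ → zeroZ p) ≈q-refl
                       (λ { zero → zeroZ-*q (+ 0) (ι p x) }))
                     (≃⇒≈q (+ 0) (0+[x+0]≃x (zeroZ p)))

module Juggling (p : ℕ) .{{_ : NonZero p}} (1<p : 1 ℕ.< p) (m : ℕ) where
  open import Data.Integer using (_+_; _*_; -_; _-_)
  open import Relation.Binary.PropositionalEquality using (_≢_)
  open import Data.Bool using (true; false)
  open ℤ-Solver using (solve-∀)
  open Congruence
  open DigitStreams p
  open Residues p
  open OneAndNegation p 1<p
  open CoherentLimits p
  open Steps p 1<p m

  M : ℕ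
  M = ℕ.suc m

  residue-offset : ∀ n k x w → residue n (offset k x w) ≡ - + k + (residue n x + residue n w) [mod p^ n ]
  residue-offset n k x w = begin
    residue n (offset k x w)
      ≈⟨ residue-+z n (-z_ p (fromℕ k)) (_+z_ p x w) ⟩
    residue n (-z_ p (fromℕ k)) + residue n (_+z_ p x w)
      ≈⟨ +-cong-mod (≡-mod-trans (residue--z n (fromℕ k)) (-‿cong-mod (residue-fromℕ n k))) (residue-+z n x w) ⟩
    - + k + (residue n x + residue n w) ∎
    where open ≡-mod-Reasoning (p^ n)

  step-divisible : ∀ {k x w} W → offset k x w ≃ shiftZ p M W → step k x w ≃ W
  step-divisible {k} {x} {w} W offset≃ with firstZero p (offset k x w) M in fz
  ... | true  = ≃-trans (drop-cong M offset≃) (drop-shiftZ M W)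
  ... | false = contradiction (trans (sym fz) shifted-firstZero) λ ()
    where
    shifted-firstZero : firstZero p (offset k x w) M ≡ true
    shifted-firstZero = trans (firstZero-cong M offset≃) (digit≡0⇒firstZero M (shiftZ-low M W))

  step-indivisible : ∀ {k x w} → w ≃ zeroZ p → k ℕ.< p ℕ.^ M → k ≢ value M x → step k x w ≃ zeroZ p
  step-indivisible {k} {x} {w} w≃0 k<p^M k≢x with firstZero p (offset k x w) M in fz
  ... | false = ≃-refl
  ... | true  = contradiction (≡-mod⇒≡ k<p^M (value<p^n M x) k≡x) k≢x
    where
    y = offset k x w
    y≡0 : residue M y ≡ + 0 [mod p^ M ]
    y≡0 = begin
      residue M y
        ≡⟨ residue-cong M (low-digits≡0⇒≃shiftZ M (firstZero⇒digit≡0 fz)) ⟩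
      residue M (shiftZ p M (drop M y))
        ≈⟨ residue-shiftZ M M (drop M y) ⟩
      p^ M * residue M (drop M y)
        ≡⟨ ℤ.*-comm (p^ M) _ ⟩
      residue M (drop M y) * p^ M
        ≈⟨ multiple≡0-mod (residue M (drop M y)) ⟩
      + 0 ∎
      where open ≡-mod-Reasoning (p^ M)
    k≡x : + k ≡ residue M x [mod p^ M ]
    k≡x = begin
      + k
        ≡⟨ ℤ.+-identityʳ (+ k) ⟨
      + k + + 0
        ≈⟨ +-congˡ-mod (+ k) y≡0 ⟨
      + k + residue M y
        ≈⟨ +-congˡ-mod (+ k) (residue-offset M k x w) ⟩
      + k + (- + k + (residue M x + residue M w))
        ≡⟨ cancel (+ k) (residue M x) (residue M w) ⟩
      residue M x + residue M w
        ≡⟨ cong (λ r → residue M x + r) (trans (residue-cong M w≃0) (residue-zeroZ M)) ⟩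
      residue M x + + 0
        ≡⟨ ℤ.+-identityʳ (residue M x) ⟩
      residue M x ∎
      where
      open ≡-mod-Reasoning (p^ M)
      cancel : ∀ k a b → k + (- k + (a + b)) ≡ a + b
      cancel = solve-∀

  run-+ : ∀ k n d x w → run k (n ℕ.+ d) x w ≡ run (k ℕ.+ n) d x (run k n x w)
  run-+ k ℕ.zero    d x w rewrite ℕ.+-identityʳ k = refl
  run-+ k (ℕ.suc n) d x w rewrite ℕ.+-suc k n = run-+ (ℕ.suc k) n d x (step k x w)

  run-below : ∀ k n {x w} → k ℕ.+ n ℕ.≤ value M x → w ≃ zeroZ p → run k n x w ≃ zeroZ p
  run-below k ℕ.zero      _   w≃0 = w≃0
  run-below k (ℕ.suc n) {x} k+n<x w≃0 =
    run-below (ℕ.suc k) n (subst (ℕ._≤ value M x) (ℕ.+-suc k n) k+n<x)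
      (step-indivisible w≃0 (ℕ.<-≤-trans k<x (ℕ.<⇒≤ (value<p^n M x))) (ℕ.<⇒≢ k<x))
    where
    k<x : k ℕ.< value M x
    k<x = ℕ.<-≤-trans (ℕ.s≤s (ℕ.m≤m+n k n)) (subst (ℕ._≤ value M x) (ℕ.+-suc k n) k+n<x)

  target : ℕ → ℕ → Zp p → Zp p → Zp p
  target k ℕ.zero    y x = y
  target k (ℕ.suc n) y x = _+z_ p (shiftZ p M (target (ℕ.suc k) n y x)) (_+z_ p (-z_ p x) (fromℕ k))

  residue-target-suc : ∀ n k d y x →
    residue n (target k (ℕ.suc d) y x) ≡ p^ M * residue n (target (ℕ.suc k) d y x) + (- residue n x + + k) [mod p^ n ]
  residue-target-suc n k d y x = begin
    residue n (target k (ℕ.suc d) y x)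
      ≈⟨ residue-+z n (shiftZ p M (target (ℕ.suc k) d y x)) (_+z_ p (-z_ p x) (fromℕ k)) ⟩
    residue n (shiftZ p M (target (ℕ.suc k) d y x)) + residue n (_+z_ p (-z_ p x) (fromℕ k))
      ≈⟨ +-cong-mod (residue-shiftZ n M (target (ℕ.suc k) d y x))
                    (≡-mod-trans (residue-+z n (-z_ p x) (fromℕ k)) (+-cong-mod (residue--z n x) (residue-fromℕ n k))) ⟩
    p^ M * residue n (target (ℕ.suc k) d y x) + (- residue n x + + k) ∎
    where open ≡-mod-Reasoning (p^ n)

  run-target : ∀ k d y x {w} → w ≃ target k d y x → run k d x w ≃ y
  run-target k ℕ.zero    y x w≃ = w≃
  run-target k (ℕ.suc d) y x {w} w≃ = run-target (ℕ.suc k) d y x (step-divisible {k} T offset≃)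
    where
    T = target (ℕ.suc k) d y x
    offset≃ : offset k x w ≃ shiftZ p M T
    offset≃ = ≃-from-residues λ n → let open ≡-mod-Reasoning (p^ n) in begin
      residue n (offset k x w)
        ≈⟨ residue-offset n k x w ⟩
      - + k + (residue n x + residue n w)
        ≈⟨ +-congˡ-mod (- + k) (+-congˡ-mod (residue n x) (≡-mod-trans (≡⇒≡-mod (residue-cong n w≃))
                                                                        (residue-target-suc n k d y x))) ⟩
      - + k + (residue n x + (p^ M * residue n T + (- residue n x + + k)))
        ≡⟨ cancel (+ k) (residue n x) (p^ M * residue n T) ⟩
      p^ M * residue n T
        ≈⟨ residue-shiftZ n M T ⟨
      residue n (shiftZ p M T) ∎
      where
      cancel : ∀ k r s → - k + (r + (s + (- r + k))) ≡ s
      cancel = solve-∀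

  slope : ℕ → ℕ
  slope ℕ.zero    = 0
  slope (ℕ.suc d) = p ℕ.^ M ℕ.* slope d ℕ.+ 1

  residue-target : ∀ n k d y x →
    residue n (target k d y x) ≡ residue n (target k d y (zeroZ p)) - + slope d * residue n x [mod p^ n ]
  residue-target n k ℕ.zero    y x = ≡⇒≡-mod (no-slope (residue n y) (residue n x))
    where
    no-slope : ∀ t r → t ≡ t - + 0 * r
    no-slope = solve-∀
  residue-target n k (ℕ.suc d) y x = begin
    residue n (target k (ℕ.suc d) y x)
      ≈⟨ residue-target-suc n k d y x ⟩
    p^ M * residue n (target (ℕ.suc k) d y x) + (- r + + k)
      ≈⟨ +-congʳ-mod (- r + + k) (*-congˡ-mod (p^ M) (residue-target n (ℕ.suc k) d y x)) ⟩
    p^ M * (t - + slope d * r) + (- r + + k)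
      ≡⟨ regroup (p^ M) t (+ slope d) r (+ k) ⟩
    (p^ M * t + (- + 0 + + k)) - (p^ M * + slope d + + 1) * r
      ≡⟨ cong₂ (λ z s → (p^ M * t + (- z + + k)) - s * r) (sym (residue-zeroZ n)) (sym slope≡) ⟩
    (p^ M * t + (- residue n (zeroZ p) + + k)) - + slope (ℕ.suc d) * r
      ≈⟨ +-congʳ-mod (- (+ slope (ℕ.suc d) * r)) (residue-target-suc n k d y (zeroZ p)) ⟨
    residue n (target k (ℕ.suc d) y (zeroZ p)) - + slope (ℕ.suc d) * r ∎
    where
    open ≡-mod-Reasoning (p^ n)
    r = residue n x
    t = residue n (target (ℕ.suc k) d y (zeroZ p))
    slope≡ : + slope (ℕ.suc d) ≡ p^ M * + slope d + + 1
    slope≡ = trans (ℤ.pos-+ (p ℕ.^ M ℕ.* slope d) 1) (cong (_+ + 1) (ℤ.pos-* (p ℕ.^ M) (slope d)))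
    regroup : ∀ P t s r k → P * (t - s * r) + (- r + k) ≡ (P * t + (- + 0 + k)) - (P * s + + 1) * r
    regroup = solve-∀

  juggle : Zp p → Zp p
  juggle x = run 0 (p ℕ.^ M) x (zeroZ p)

  -- x - j = p^M · w, where w is the value that the layers after layer j turn into y.
  Hits : ℕ → Zp p → Zp p → Set
  Hits j y x = ∀ n →
    residue n x - + j ≡ p^ M * residue n (target (ℕ.suc j) (p ℕ.^ M ℕ.∸ ℕ.suc j) y x) [mod p^ n ]

  Hits⇒≡-mod : ∀ {j y x} → Hits j y x → residue M x ≡ + j [mod p^ M ]
  Hits⇒≡-mod {j} {y} {x} hits = begin
    residue M x                     ≡⟨ split (residue M x) (+ j) ⟩
    (residue M x - + j) + + j       ≈⟨ +-congʳ-mod (+ j) (hits M) ⟩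
    p^ M * c + + j                  ≡⟨ cong (_+ + j) (ℤ.*-comm (p^ M) c) ⟩
    c * p^ M + + j                  ≈⟨ +-congʳ-mod (+ j) (multiple≡0-mod c) ⟩
    + 0 + + j                       ≡⟨ ℤ.+-identityˡ (+ j) ⟩
    + j                             ∎
    where
    open ≡-mod-Reasoning (p^ M)
    c = residue M (target (ℕ.suc j) (p ℕ.^ M ℕ.∸ ℕ.suc j) y x)
    split : ∀ r j → r ≡ (r - j) + j
    split = solve-∀

  Hits⇒juggle≃ : ∀ {j y x} → j ℕ.< p ℕ.^ M → Hits j y x → juggle x ≃ y
  Hits⇒juggle≃ {j} {y} {x} j<p^M hits =
    subst (λ n → run 0 n x (zeroZ p) ≃ y) p^M≡j+1+D
      (subst (_≃ y) (sym (run-+ 0 j (ℕ.suc D) x (zeroZ p)))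
        (run-target (ℕ.suc j) D y x (step-divisible {j} T offset≃)))
    where
    D = p ℕ.^ M ℕ.∸ ℕ.suc j
    T = target (ℕ.suc j) D y x
    p^M≡j+1+D : j ℕ.+ ℕ.suc D ≡ p ℕ.^ M
    p^M≡j+1+D = trans (ℕ.+-suc j D) (ℕ.m+[n∸m]≡n j<p^M)
    w₀≃0 : run 0 j x (zeroZ p) ≃ zeroZ p
    w₀≃0 = run-below 0 j (ℕ.≤-reflexive (sym (≡-mod⇒≡ (value<p^n M x) j<p^M (Hits⇒≡-mod hits)))) ≃-refl
    offset≃ : offset j x (run 0 j x (zeroZ p)) ≃ shiftZ p M T
    offset≃ = ≃-from-residues λ n → let open ≡-mod-Reasoning (p^ n) in begin
      residue n (offset j x (run 0 j x (zeroZ p)))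
        ≈⟨ residue-offset n j x _ ⟩
      - + j + (residue n x + residue n (run 0 j x (zeroZ p)))
        ≡⟨ cong (λ t → - + j + (residue n x + t)) (trans (residue-cong n w₀≃0) (residue-zeroZ n)) ⟩
      - + j + (residue n x + + 0)
        ≡⟨ regroup (+ j) (residue n x) ⟩
      residue n x - + j
        ≈⟨ hits n ⟩
      p^ M * residue n T
        ≈⟨ residue-shiftZ n M T ⟨
      residue n (shiftZ p M T) ∎
      where
      regroup : ∀ j r → - j + (r + + 0) ≡ r - j
      regroup = solve-∀

  hits : ∀ j y → Σ (Zp p) (Hits j y)
  hits j y = x , λ n → let open ≡-mod-Reasoning (p^ n) ; r = residue n x in begin
    r - + j
      ≡⟨ expand r (+ j) (p^ M) (+ s) ⟩
    (+ 1 + p^ M * + s) * r - + j - p^ M * (+ s * r)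
      ≈⟨ +-congʳ-mod (- (p^ M * (+ s * r))) (+-congʳ-mod (- + j) (equation n)) ⟩
    + j + p^ M * residue n T₀ - + j - p^ M * (+ s * r)
      ≡⟨ collect (+ j) (p^ M) (residue n T₀) (+ s) r ⟩
    p^ M * (residue n T₀ - + s * r)
      ≈⟨ *-congˡ-mod (p^ M) (residue-target n (ℕ.suc j) D y x) ⟨
    p^ M * residue n (target (ℕ.suc j) D y x) ∎
    where
    D = p ℕ.^ M ℕ.∸ ℕ.suc j
    s = slope D
    T₀ = target (ℕ.suc j) D y (zeroZ p)
    c = p ℕ.^ m ℕ.* s
    solved = 1+p*c·-surjective c (_+z_ p (fromℕ j) (shiftZ p M T₀))
    x = proj₁ solved
    coefficient : + 1 + p^ M * + s ≡ + ℕ.suc (p ℕ.* c)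
    coefficient = sym (trans (ℤ.pos-+ 1 (p ℕ.* c)) (cong (λ t → + 1 + t)
                    (trans (cong +_ (sym (ℕ.*-assoc p (p ℕ.^ m) s))) (ℤ.pos-* (p ℕ.^ M) s))))
    equation : ∀ n → (+ 1 + p^ M * + s) * residue n x ≡ + j + p^ M * residue n T₀ [mod p^ n ]
    equation n = begin
      (+ 1 + p^ M * + s) * residue n x                 ≡⟨ cong (_* residue n x) coefficient ⟩
      + ℕ.suc (p ℕ.* c) * residue n x                  ≈⟨ residue-· n (ℕ.suc (p ℕ.* c)) x ⟨
      residue n (ℕ.suc (p ℕ.* c) · x)                  ≡⟨ residue-cong n (proj₂ solved) ⟩
      residue n (_+z_ p (fromℕ j) (shiftZ p M T₀))     ≈⟨ residue-+z n (fromℕ j) (shiftZ p M T₀) ⟩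
      residue n (fromℕ j) + residue n (shiftZ p M T₀)  ≈⟨ +-cong-mod (residue-fromℕ n j) (residue-shiftZ n M T₀) ⟩
      + j + p^ M * residue n T₀                        ∎
      where open ≡-mod-Reasoning (p^ n)
    expand : ∀ r j P s → r - j ≡ (+ 1 + P * s) * r - j - P * (s * r)
    expand = solve-∀
    collect : ∀ j P t s r → j + P * t - j - P * (s * r) ≡ P * (t - s * r)
    collect = solve-∀

  juggle-isJuggling : IsJuggling p M juggle
  juggle-isJuggling y a = x , ≡-mod⇒InCoset M (Hits⇒≡-mod x-hits) , digit-eq (Hits⇒juggle≃ (value<p^n M a) x-hits)
    where
    x = proj₁ (hits (value M a) y)
    x-hits = proj₂ (hits (value M a) y)

lemma3p16 : (p : ℕ) .{{_ : NonZero p}} → Prime p → (m : ℕ) → 1 ≤ m →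
    Σ (Zp p → Zp p) (λ g → IsJuggling p m g ×
      Σ (Net p 1 2) (λ N → width p N ≡ 2 ×
        ((x : Zp p) →
          _≈_ p (eval p N (λ _ → ι p x) zero) (ι p x) ×
          _≈_ p (eval p N (λ _ → ι p x) (suc zero)) (ι p (g x)))))
lemma3p16 p prime-p (ℕ.suc m) _ =
  juggle , juggle-isJuggling , network layerCount , width-network layerCount ,
  λ x → ≈q⇒≈ (proj₁ (eval-network layerCount x)) , ≈q⇒≈ (proj₂ (eval-network layerCount x))
  where
  1<p : 1 ℕ.< p
  1<p = ℕ.nonTrivial⇒n>1 p {{prime⇒nonTrivial prime-p}}
  layerCount : ℕ
  layerCount = p ℕ.^ ℕ.suc m
  open Juggling p 1<p m
  open Network p 1<p m
  open PAdicNumbers p
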